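{- Let $m\geq 3$ be an integer. For $3\leq \ell\leq 2m-3$, let $\zeta_{\ell,m}\in S_{2m-3}$ be the permutation obtained from the identity permutation $123\cdots(2m-3)$ by swapping the entries $1$ and $2$ and then moving the entry $\ell$ to the beginning, i.e. $\zeta_{\ell,m}=\ell\,2\,1\,3\,4\cdots(\ell-1)(\ell+1)\cdots(2m-3)$. A permutation $\pi\in S_{2m-3}$ lies in $s^{m-3}(S_{2m-3})$ if and only if one of the following holds: (i) $\operatorname{tl}(\pi)\geq m-3$ and every descent top of $\pi$ is a left-to-right maximum of $\pi$; or (ii) $\pi=\zeta_{\ell,m}$ for some $\ell\in\{3,\ldots,m\}$. Consequently, $|s^{m-3}(S_{2m-3})|=B_m+m-2$, where $B_m$ is the $m$-th Bell number.
   Context: A permutation is an ordering of a finite set of positive integers, written in one-line notation; $S_n$ is the set of permutations of $[n]=\{1,\ldots,n\}$. West's stack-sorting map $s$ is defined recursively: $s$ sends the empty permutation to itself, and for a nonempty permutation $\pi=LmR$ with $m$ its largest entry, $s(\pi)=s(L)\,s(R)\,m$. $s^t$ denotes the $t$-fold iterate. For $\pi=\pi_1\cdots\pi_n$, a descent top is an entry $\pi_i$ with $\pi_i>\pi_{i+1}$. A left-to-right maximum is an entry $\pi_j$ with $\pi_j>\pi_\ell$ for all $\ell<j$. The tail length $\operatorname{tl}(\pi)$ of $\pi\in S_n$ is the largest $\ell\in\{0,\ldots,n\}$ such that $\pi_i=i$ for all $i\in\{n-\ell+1,\ldots,n\}$. The Bell number $B_m$ is the number of set partitions of $[m]$. 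-}

module Defs where

open import Data.Nat using (ℕ; zero; suc; _+_; _*_; _∸_; _⊔_; _<_; _≤_; _≡ᵇ_)
open import Data.Nat.Combinatorics using (_C_)
open import Data.Bool using (if_then_else_)
open import Data.List using (List; []; _∷_; _++_; [_]; length; reverse; foldr; filter; map; upTo)
open import Data.Nat.ListAction using (sum)
open import Data.List.Relation.Unary.All using (All)
open import Data.List.Relation.Binary.Permutation.Propositional using (_↭_)
open import Data.Product using (Σ; ∃; _×_; _,_)
open import Relation.Binary.PropositionalEquality using (_≡_; _≢_)
open import Relation.Nullary using (¬_)
open import Data.Nat using (_≟_)
open import Relation.Nullary.Decidable using (¬?)
open import Function using (_∘_)

range1 : ℕ → List ℕ
range1 n = map suc (upTo n)

-- π ∈ S_n : π is an ordering of [n] in one-line notation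
IsPerm : ℕ → List ℕ → Set
IsPerm n π = π ↭ range1 n

maxL : List ℕ → ℕ
maxL = foldr _⊔_ 0

splitAt≡ : ℕ → List ℕ → List ℕ × List ℕ
splitAt≡ m [] = [] , []
splitAt≡ m (x ∷ xs) with x ≡ᵇ m
... | Data.Bool.true  = [] , xs
... | Data.Bool.false with splitAt≡ m xs
...   | (L , R) = x ∷ L , R

-- West's stack-sorting map s(LmR) = s(L) s(R) m, with fuel (fuel = length suffices)
sF : ℕ → List ℕ → List ℕ
sF zero    _  = []
sF (suc f) [] = []
sF (suc f) π@(_ ∷ _) with splitAt≡ (maxL π) π
... | (L , R) = sF f L ++ sF f R ++ [ maxL π ]

s : List ℕ → List ℕ
s π = sF (length π) π

iter : ℕ → (List ℕ → List ℕ) → List ℕ → List ℕ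
iter zero    f x = x
iter (suc t) f x = f (iter t f x)

InImage : ℕ → ℕ → List ℕ → Set
InImage t n π = Σ (List ℕ) λ σ → IsPerm n σ × iter t s σ ≡ π

DescentTop : List ℕ → ℕ → Set
DescentTop π x = Σ (List ℕ) λ ys → Σ ℕ λ y → Σ (List ℕ) λ zs →
  (π ≡ ys ++ x ∷ y ∷ zs) × (y < x)

LRMax : List ℕ → ℕ → Set
LRMax π x = Σ (List ℕ) λ ys → Σ (List ℕ) λ zs →
  (π ≡ ys ++ x ∷ zs) × All (_< x) ys

-- tail length of π ∈ S_n : largest ℓ with π_i = i for n-ℓ+1 ≤ i ≤ n
tlGo : ℕ → List ℕ → ℕ
tlGo (suc k) (x ∷ xs) = if x ≡ᵇ suc k then suc (tlGo k xs) else 0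
tlGo _ _ = 0

tl : ℕ → List ℕ → ℕ
tl n π = tlGo n (reverse π)

zeta : ℕ → ℕ → List ℕ
zeta ℓ m = ℓ ∷ 2 ∷ 1 ∷ filter (λ x → ¬? (x ≟ ℓ)) (map (λ i → i + 3) (upTo (2 * m ∸ 5)))

bellList : ℕ → List ℕ   -- bellList n = [B_0, …, B_{n-1}]
bellList zero = []
bellList (suc n) = bellList n ++ [ bellNext n (bellList n) ]
  where
  bellNext : ℕ → List ℕ → ℕ
  bellNext zero _ = 1
  bellNext (suc n') bs = sum (Data.List.zipWith (λ k b → (n' C k) * b) (upTo (suc n')) bs)

bell : ℕ → ℕ
bell n = Data.List.foldl (λ _ b → b) 0 (bellList (suc n))   -- last element = B_n

{-# OPTIONS --safe #-}
-- Write m = t + 3 and n = 2m − 3 = 2t + 3. Since s moves the largest entry to the end, s^k(σ) ends with the k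
-- largest entries in increasing order; this gives the tail condition. Let ndt x ρ be the number of entries of ρ
-- that exceed x and are not descent tops. A descent x z of s(σ) comes from a descent of σ with a larger top, and
-- tracing it back shows: if x is a descent top of s^t(σ) but not a left-to-right maximum, then at least 2t
-- entries after x exceed x and are not descent tops. Only n − x entries exceed x and one of them precedes x, so
-- x = 2, the next entry is 1, and the permutation is some ζ_{ℓ,m}.
-- Conversely, a permutation all of whose descent tops are left-to-right maxima is a sequence of blocks, each
-- starting with its maximum and ascending afterwards, with increasing maxima. Such a permutation followed by an
-- increasing run of larger entries has an explicit preimage under s, and so has each ζ_{ℓ,m}. Choosing the
-- entries that share a block with the maximum gives B_{k+1} = Σᵢ C(k,i) Bᵢ, so [m] has B_m block forms; the image
-- consists of these followed by m+1 ⋯ n, together with the m − 2 permutations ζ_{ℓ,m}.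
module Submission where

open import Defs
open import Data.Nat using (ℕ; zero; suc; _+_; _*_; _∸_; _<_; _≤_; _>_; z≤n; s≤s; _≤?_; _<?_; _≟_)
open import Data.Nat.Properties
open import Data.Nat.ListAction using (sum)
open import Data.Nat.ListAction.Properties using (sum-++)
open import Data.Nat.Combinatorics using (_C_; nCk+nC[k+1]≡[n+1]C[k+1]; k>n⇒nCk≡0)
open import Data.List
  using (List; []; _∷_; _++_; [_]; length; reverse; map; filter; upTo; applyUpTo; applyDownFrom; concatMap; zipWith; foldl)
open import Data.List.Properties
  using (++-assoc; ++-identityʳ; ++-conicalʳ; ++-cancelʳ; ∷-injective; ∷-injectiveˡ; ∷ʳ-injective; ≡-dec;
         length-++; length-map; length-upTo; length-applyDownFrom; length-filter;
         map-cong; map-cong-local; map-∘; map-++; map-upTo; upTo-∷ʳ; applyUpTo-∷ʳ;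
         reverse-++; reverse-involutive; reverse-injective; unfold-reverse; filter-++; filter-all; filter-none)
open import Data.List.Membership.Propositional using (_∈_; _∉_; find; lose)
open import Data.List.Membership.Propositional.Properties
  using (∈-insert; ∈-∃++; ∈-++⁺ˡ; ∈-++⁺ʳ; ∈-++⁻; ∈-map⁺; ∈-map⁻; ∈-filter⁺; ∈-filter⁻; ∈-concatMap⁺; ∈-concatMap⁻;
         ∈-applyDownFrom⁺; ∈-applyDownFrom⁻)
open import Data.List.Membership.DecPropositional _≟_ using (_∈?_)
open import Data.List.Relation.Unary.All as All using (All; []; _∷_)
import Data.List.Relation.Unary.All.Properties as All
open import Data.List.Relation.Unary.All.Properties using (All¬⇒¬Any; ¬All⇒Any¬)
open import Data.List.Relation.Unary.Any using (Any; here; there)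
import Data.List.Relation.Unary.Any.Properties as Any
open import Data.List.Relation.Unary.AllPairs as AllPairs using (AllPairs; []; _∷_)
import Data.List.Relation.Unary.AllPairs.Properties as AllPairs
open import Data.List.Relation.Unary.Unique.Propositional using (Unique)
import Data.List.Relation.Unary.Unique.Propositional.Properties as Unique
open import Data.List.Relation.Binary.Permutation.Propositional using (_↭_; ↭-refl; ↭-sym; ↭-trans; prep; ↭⇒↭ₛ)
open import Data.List.Relation.Binary.Permutation.Propositional.Properties
  using (∈-resp-↭; All-resp-↭; shift; ++⁺; ++⁺ʳ; ++-comm; drop-mid; ↭-length; filter-↭; ↭-reverse)
import Data.List.Relation.Binary.Permutation.Setoid.Properties as PermutationSetoid
open import Data.List.Relation.Ternary.Interleaving.Propositional using (Interleaving; []; consˡ; consʳ; toPermutation)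
open import Data.List.Relation.Ternary.Interleaving.Properties using (interleave-length)
open import Data.Product using (Σ; ∃-syntax; _×_; _,_; proj₁; proj₂; map₁; map₂)
open import Data.Sum using (_⊎_; inj₁; inj₂)
open import Data.Empty using (⊥-elim)
open import Function using (_∘_)
open import Function.Bundles using (_⇔_; mk⇔)
open import Relation.Nullary using (¬_; yes; no; Dec; ¬?)
open import Relation.Nullary.Decidable using (dec-true; dec-false)
open import Relation.Binary.PropositionalEquality as ≡ using (_≡_; _≢_; ≢-sym; refl; sym; cong; cong₂; subst)

module _ {A : Set} where

  AllPairs-++⁻ : ∀ {R : A → A → Set} xs {ys} → AllPairs R (xs ++ ys) →
                 AllPairs R xs × AllPairs R ys × All (λ x → All (R x) ys) xs
  AllPairs-++⁻ []       p       = [] , p , []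
  AllPairs-++⁻ (x ∷ xs) (a ∷ p) with AllPairs-++⁻ xs p
  ... | pxs , pys , pxys = All.++⁻ˡ xs a ∷ pxs , pys , All.++⁻ʳ xs a ∷ pxys

  Unique-resp-↭ : ∀ {xs ys : List A} → xs ↭ ys → Unique xs → Unique ys
  Unique-resp-↭ p = PermutationSetoid.Unique-resp-↭ (≡.setoid A) (↭⇒↭ₛ p)

  Unique-++⁻ˡ : ∀ xs {ys : List A} → Unique (xs ++ ys) → Unique xs
  Unique-++⁻ˡ xs u = proj₁ (AllPairs-++⁻ xs u)

  Unique-++⁻ʳ : ∀ xs {ys : List A} → Unique (xs ++ ys) → Unique ys
  Unique-++⁻ʳ xs u = proj₁ (proj₂ (AllPairs-++⁻ xs u))

  Unique-++-disjoint : ∀ xs {ys : List A} {v} → Unique (xs ++ ys) → v ∈ xs → v ∉ ys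
  Unique-++-disjoint xs u v∈xs v∈ys =
    All.lookup (All.lookup (proj₂ (proj₂ (AllPairs-++⁻ xs u))) v∈xs) v∈ys refl

  Unique-mid-∉ : ∀ {x : A} ys {zs} → Unique (ys ++ x ∷ zs) → x ∉ ys × x ∉ zs
  Unique-mid-∉ ys u =
    (λ x∈ys → Unique-++-disjoint ys u x∈ys (here refl)) ,
    (λ x∈zs → All.lookup (AllPairs.head (Unique-++⁻ʳ ys u)) x∈zs refl)

  ∉-++-∷-cancel : ∀ {x : A} ys ys′ {zs zs′} → x ∉ ys → x ∉ ys′ →
                  ys ++ x ∷ zs ≡ ys′ ++ x ∷ zs′ → ys ≡ ys′ × zs ≡ zs′
  ∉-++-∷-cancel []       []         _  _   e = refl , proj₂ (∷-injective e)
  ∉-++-∷-cancel []       (y ∷ ys′)  _  x∉′ e = ⊥-elim (x∉′ (here (proj₁ (∷-injective e))))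
  ∉-++-∷-cancel (y ∷ ys) []         x∉ _   e = ⊥-elim (x∉ (here (sym (proj₁ (∷-injective e)))))
  ∉-++-∷-cancel (y ∷ ys) (y′ ∷ ys′) x∉ x∉′ e with ∷-injective e
  ... | refl , e′ with ∉-++-∷-cancel ys ys′ (x∉ ∘ there) (x∉′ ∘ there) e′
  ...   | refl , zs≡zs′ = refl , zs≡zs′

  Unique-++-∷-cancel : ∀ {x : A} ys ys′ {zs zs′} → Unique (ys ++ x ∷ zs) →
                       ys ++ x ∷ zs ≡ ys′ ++ x ∷ zs′ → ys ≡ ys′
  Unique-++-∷-cancel ys ys′ u e = proj₁ (∉-++-∷-cancel ys ys′ (proj₁ (Unique-mid-∉ ys u))
    (proj₁ (Unique-mid-∉ ys′ (subst Unique e u))) e)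

  Unique-remove : ∀ {x : A} ys {zs} → Unique (ys ++ x ∷ zs) → Unique (ys ++ zs)
  Unique-remove []       (_ ∷ u) = u
  Unique-remove (y ∷ ys) (a ∷ u) = All.++⁺ (All.++⁻ˡ ys a) (All.tail (All.++⁻ʳ ys a)) ∷ Unique-remove ys u

  Unique⇒↭ : ∀ {xs ys : List A} → Unique xs → Unique ys →
             (∀ {z} → z ∈ xs → z ∈ ys) → (∀ {z} → z ∈ ys → z ∈ xs) → xs ↭ ys
  Unique⇒↭ {[]}     {[]}    _ _ _ _ = ↭-refl
  Unique⇒↭ {[]}     {_ ∷ _} _ _ _ ⊇ with ⊇ (here refl)
  ... | ()
  Unique⇒↭ {x ∷ xs} (x∉xs ∷ uxs) uys ⊆ ⊇ with ∈-∃++ (⊆ (here refl))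
  ... | ys₁ , ys₂ , refl =
    ↭-trans (prep x (Unique⇒↭ uxs (Unique-remove ys₁ uys) ⊆′ ⊇′)) (↭-sym (shift x ys₁ ys₂))
    where
    ⊆′ : ∀ {z} → z ∈ xs → z ∈ ys₁ ++ ys₂
    ⊆′ z∈xs with ∈-++⁻ ys₁ (⊆ (there z∈xs))
    ... | inj₁ z∈ys₁         = ∈-++⁺ˡ z∈ys₁
    ... | inj₂ (here refl)   = ⊥-elim (All.lookup x∉xs z∈xs refl)
    ... | inj₂ (there z∈ys₂) = ∈-++⁺ʳ ys₁ z∈ys₂
    ⊇′ : ∀ {z} → z ∈ ys₁ ++ ys₂ → z ∈ xs
    ⊇′ z∈ys with ⊇ (∈-resp-↭ (↭-sym (shift x ys₁ ys₂)) (there z∈ys))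
    ... | there z∈xs = z∈xs
    ... | here refl with ∈-++⁻ ys₁ z∈ys | Unique-mid-∉ ys₁ uys
    ...   | inj₁ x∈ys₁ | x∉ys₁ , _ = ⊥-elim (x∉ys₁ x∈ys₁)
    ...   | inj₂ x∈ys₂ | _ , x∉ys₂ = ⊥-elim (x∉ys₂ x∈ys₂)

Unique-concatMap : ∀ {A B : Set} (f : A → List B) {xs} → Unique xs → (∀ {x} → x ∈ xs → Unique (f x)) →
                   (∀ {x x′ y} → x ∈ xs → x′ ∈ xs → y ∈ f x → y ∈ f x′ → x ≡ x′) → Unique (concatMap f xs)
Unique-concatMap f {[]}     _        _  _    = []
Unique-concatMap f {x ∷ xs} (x∉ ∷ u) uf same =
  Unique.++⁺ (uf (here refl)) (Unique-concatMap f u (uf ∘ there) (λ x∈ x′∈ → same (there x∈) (there x′∈))) disjoint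
  where
  disjoint : ∀ {y} → ¬ (y ∈ f x × y ∈ concatMap f xs)
  disjoint (y∈fx , y∈) with find (∈-concatMap⁻ f y∈)
  ... | x′ , x′∈ , y∈fx′ = All.lookup x∉ x′∈ (same (here refl) (there x′∈) y∈fx y∈fx′)

length-concatMap : ∀ {A B : Set} (f : A → List B) xs → length (concatMap f xs) ≡ sum (map (length ∘ f) xs)
length-concatMap f []       = refl
length-concatMap f (x ∷ xs) = ≡.trans (length-++ (f x)) (cong (length (f x) +_) (length-concatMap f xs))

snoc-view : ∀ (xs : List ℕ) {j} → length xs ≡ suc j → ∃[ xs′ ] ∃[ x ] xs ≡ xs′ ++ [ x ] × length xs′ ≡ j
snoc-view (x ∷ [])     {zero}  _ = [] , x , refl , refl
snoc-view (x ∷ y ∷ xs) {suc j} e with snoc-view (y ∷ xs) (suc-injective e)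
... | xs′ , z , xs≡ , |xs′| = x ∷ xs′ , z , cong (x ∷_) xs≡ , cong suc |xs′|

length-filter-≢ : ∀ {ℓ} xs → Unique xs → ℓ ∈ xs → suc (length (filter (λ x → ¬? (x ≟ ℓ)) xs)) ≡ length xs
length-filter-≢ {ℓ} (x ∷ xs) (x∉ ∷ _) (here refl)
  rewrite dec-false (¬? (x ≟ x)) (λ x≢x → x≢x refl) | filter-all (λ y → ¬? (y ≟ x)) (All.map ≢-sym x∉) = refl
length-filter-≢ {ℓ} (x ∷ xs) (x∉ ∷ u) (there ℓ∈)
  rewrite dec-true (¬? (x ≟ ℓ)) (λ { refl → All.lookup x∉ ℓ∈ refl }) = cong suc (length-filter-≢ xs u ℓ∈)

Ascending : List ℕ → Set
Ascending = AllPairs _<_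

Descending : List ℕ → Set
Descending = AllPairs _>_

Ascending⇒Unique : ∀ {xs} → Ascending xs → Unique xs
Ascending⇒Unique = AllPairs.map <⇒≢

Descending⇒Unique : ∀ {xs} → Descending xs → Unique xs
Descending⇒Unique = AllPairs.map >⇒≢

Descending-reverse : ∀ {xs} → Descending xs → Ascending (reverse xs)
Descending-reverse {[]}     []           = []
Descending-reverse {x ∷ xs} (x>xs ∷ dxs) = subst Ascending (sym (unfold-reverse x xs))
  (AllPairs.++⁺ (Descending-reverse dxs) ([] ∷ []) (All-resp-↭ (↭-sym (↭-reverse xs)) (All.map (_∷ []) x>xs)))

Ascending-determined : ∀ {xs ys} → Ascending xs → Ascending ys →
              (∀ {z} → z ∈ xs → z ∈ ys) → (∀ {z} → z ∈ ys → z ∈ xs) → xs ≡ ys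
Ascending-determined {[]}     {[]}     _ _ _ _ = refl
Ascending-determined {[]}     {_ ∷ _}  _ _ _ ⊇ with ⊇ (here refl)
... | ()
Ascending-determined {_ ∷ _}  {[]}     _ _ ⊆ _ with ⊆ (here refl)
... | ()
Ascending-determined {x ∷ xs} {y ∷ ys} (x<xs ∷ axs) (y<ys ∷ ays) ⊆ ⊇ with heads-≡ (⊆ (here refl)) (⊇ (here refl))
  where
  heads-≡ : x ∈ y ∷ ys → y ∈ x ∷ xs → x ≡ y
  heads-≡ (here x≡y)  _           = x≡y
  heads-≡ _           (here y≡x)  = sym y≡x
  heads-≡ (there x∈ys) (there y∈xs) = ⊥-elim (<-asym (All.lookup x<xs y∈xs) (All.lookup y<ys x∈ys))
... | refl = cong (x ∷_) (Ascending-determined axs ays ⊆′ ⊇′)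
  where
  ⊆′ : ∀ {z} → z ∈ xs → z ∈ ys
  ⊆′ z∈xs with ⊆ (there z∈xs)
  ... | here refl  = ⊥-elim (<-irrefl refl (All.lookup x<xs z∈xs))
  ... | there z∈ys = z∈ys
  ⊇′ : ∀ {z} → z ∈ ys → z ∈ xs
  ⊇′ z∈ys with ⊇ (there z∈ys)
  ... | here refl  = ⊥-elim (<-irrefl refl (All.lookup y<ys z∈ys))
  ... | there z∈xs = z∈xs

_≪_ : List ℕ → List ℕ → Set
X ≪ T = All (λ x → All (x <_) T) X

-- The stack-sorting map

maxL-ub : ∀ xs → All (_≤ maxL xs) xs
maxL-ub []       = []
maxL-ub (x ∷ xs) = m≤m⊔n x (maxL xs) ∷ All.map (λ h → ≤-trans h (m≤n⊔m x (maxL xs))) (maxL-ub xs)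

maxL-lub : ∀ {b} xs → All (_≤ b) xs → maxL xs ≤ b
maxL-lub []       []       = z≤n
maxL-lub (x ∷ xs) (p ∷ ps) = ⊔-lub p (maxL-lub xs ps)

maxL-∈ : ∀ x xs → maxL (x ∷ xs) ∈ x ∷ xs
maxL-∈ x []       rewrite ⊔-identityʳ x = here refl
maxL-∈ x (y ∷ ys) with ⊔-sel x (maxL (y ∷ ys))
... | inj₁ e rewrite e = here refl
... | inj₂ e rewrite e = there (maxL-∈ y ys)

maxL-mid : ∀ L {M} R → All (_< M) L → All (_≤ M) R → maxL (L ++ M ∷ R) ≡ M
maxL-mid L R L<M R≤M = ≤-antisym
  (maxL-lub (L ++ _ ∷ R) (All.++⁺ (All.map <⇒≤ L<M) (≤-refl ∷ R≤M)))
  (All.lookup (maxL-ub (L ++ _ ∷ R)) (∈-insert L))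

∈-first : ∀ {m : ℕ} {π} → m ∈ π → ∃[ L ] ∃[ R ] π ≡ L ++ m ∷ R × m ∉ L
∈-first {m} {x ∷ π} m∈ with x ≟ m
... | yes refl = [] , π , refl , λ ()
... | no x≢m with m∈
...   | here m≡x = ⊥-elim (x≢m (sym m≡x))
...   | there m∈π with ∈-first m∈π
...     | L , R , refl , m∉L = x ∷ L , R , refl , λ { (here m≡x) → x≢m (sym m≡x) ; (there m∈L) → m∉L m∈L }

splitAt≡-first : ∀ {m} L R → m ∉ L → splitAt≡ m (L ++ m ∷ R) ≡ (L , R)
splitAt≡-first {m} []      R _   rewrite dec-true (m ≟ m) refl = refl
splitAt≡-first {m} (x ∷ L) R m∉L
  rewrite dec-false (x ≟ m) (λ x≡m → m∉L (here (sym x≡m))) | splitAt≡-first L R (m∉L ∘ there) = refl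

sF-[] : ∀ f → sF f [] ≡ []
sF-[] zero    = refl
sF-[] (suc f) = refl

sF-∷ : ∀ f x xs → let (L , R) = splitAt≡ (maxL (x ∷ xs)) (x ∷ xs) in
       sF (suc f) (x ∷ xs) ≡ sF f L ++ sF f R ++ [ maxL (x ∷ xs) ]
sF-∷ f x xs with splitAt≡ (maxL (x ∷ xs)) (x ∷ xs)
... | L , R = refl

sF-split : ∀ f L {M} R → All (_< M) L → All (_≤ M) R → sF (suc f) (L ++ M ∷ R) ≡ sF f L ++ sF f R ++ [ M ]
sF-split f [] {M} R [] R≤M
  rewrite sF-∷ f M R | maxL-mid [] R [] R≤M | splitAt≡-first {M} [] R (λ ()) = refl
sF-split f (y ∷ L) {M} R L<M R≤M
  rewrite sF-∷ f y (L ++ M ∷ R) | maxL-mid (y ∷ L) R L<M R≤M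
        | splitAt≡-first (y ∷ L) R (λ M∈ → <-irrefl refl (All.lookup L<M M∈)) = refl

length-mid : ∀ L {M : ℕ} R → length (L ++ M ∷ R) ≡ suc (length L + length R)
length-mid L R = ≡.trans (length-++ L) (+-suc (length L) (length R))

fuel-mid : ∀ L {M : ℕ} R {f} → length (L ++ M ∷ R) ≤ f →
           ∃[ f′ ] f ≡ suc f′ × length L ≤ f′ × length R ≤ f′
fuel-mid L R {suc f′} ≤f with ≤-pred (subst (_≤ suc f′) (length-mid L R) ≤f)
... | ≤f′ = f′ , refl , ≤-trans (m≤m+n _ _) ≤f′ , ≤-trans (m≤n+m _ _) ≤f′
fuel-mid L R {zero} ≤f with subst (_≤ 0) (length-mid L R) ≤f
... | ()

record MaxSplit (π : List ℕ) : Set where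
  constructor maxSplit
  field
    {L} : List ℕ
    {M} : ℕ
    {R} : List ℕ
    π≡  : π ≡ L ++ M ∷ R
    L<M : All (_< M) L
    R≤M : All (_≤ M) R

max-split : ∀ x xs → MaxSplit (x ∷ xs)
max-split x xs with ∈-first (maxL-∈ x xs)
... | L , R , π≡ , M∉L = maxSplit π≡ (All.tabulate L<M) (All.tail (All.++⁻ʳ L ≤M))
  where
  ≤M : All (_≤ maxL (x ∷ xs)) (L ++ maxL (x ∷ xs) ∷ R)
  ≤M = subst (All (_≤ maxL (x ∷ xs))) π≡ (maxL-ub (x ∷ xs))
  L<M : ∀ {l} → l ∈ L → l < maxL (x ∷ xs)
  L<M l∈L = ≤∧≢⇒< (All.lookup ≤M (∈-++⁺ˡ l∈L)) (λ { refl → M∉L l∈L })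

max-induction : (P : List ℕ → Set) → P [] →
                (∀ {L M R} → All (_< M) L → All (_≤ M) R → P L → P R → P (L ++ M ∷ R)) →
                ∀ π → P π
max-induction P P[] step π = go (length π) π ≤-refl
  where
  go : ∀ f π → length π ≤ f → P π
  go _ []       _ = P[]
  go f (x ∷ xs) ≤f with max-split x xs
  ... | maxSplit {L} {M} {R} π≡ L<M R≤M with fuel-mid L R (subst (λ π → length π ≤ f) π≡ ≤f)
  ...   | f′ , refl , ≤L , ≤R = subst P (sym π≡) (step L<M R≤M (go f′ L ≤L) (go f′ R ≤R))

unique-max-induction : (P : List ℕ → Set) → P [] →
                       (∀ {L M R} → All (_< M) L → All (_< M) R → Unique L → Unique R → P L → P R → P (L ++ M ∷ R)) →
                       ∀ {π} → Unique π → P π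
unique-max-induction P P[] step {π} = max-induction (λ π → Unique π → P π) (λ _ → P[]) step′ π
  where
  step′ : ∀ {L M R} → All (_< M) L → All (_≤ M) R → (Unique L → P L) → (Unique R → P R) → Unique (L ++ M ∷ R) → P (L ++ M ∷ R)
  step′ {L} L<M R≤M ihL ihR u with Unique-++⁻ʳ L u
  ... | M∉R ∷ uR = step L<M (All.zipWith (λ (r≤M , M≢r) → ≤∧≢⇒< r≤M (≢-sym M≢r)) (R≤M , M∉R))
                        (Unique-++⁻ˡ L u) uR (ihL (Unique-++⁻ˡ L u)) (ihR uR)

sF-fuel : ∀ π {f g} → length π ≤ f → length π ≤ g → sF f π ≡ sF g π
sF-fuel = max-induction _ (λ {f} {g} _ _ → ≡.trans (sF-[] f) (sym (sF-[] g))) step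
  where
  step : ∀ {L M R} → All (_< M) L → All (_≤ M) R →
         (∀ {f g} → length L ≤ f → length L ≤ g → sF f L ≡ sF g L) →
         (∀ {f g} → length R ≤ f → length R ≤ g → sF f R ≡ sF g R) →
         ∀ {f g} → length (L ++ M ∷ R) ≤ f → length (L ++ M ∷ R) ≤ g → sF f (L ++ M ∷ R) ≡ sF g (L ++ M ∷ R)
  step {L} {M} {R} L<M R≤M ihL ihR ≤f ≤g with fuel-mid L R ≤f | fuel-mid L R ≤g
  ... | f , refl , ≤fL , ≤fR | g , refl , ≤gL , ≤gR = begin
    sF (suc f) (L ++ M ∷ R)      ≡⟨ sF-split f L R L<M R≤M ⟩
    sF f L ++ sF f R ++ [ M ]    ≡⟨ cong₂ (λ l r → l ++ r ++ [ M ]) (ihL ≤fL ≤gL) (ihR ≤fR ≤gR) ⟩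
    sF g L ++ sF g R ++ [ M ]    ≡⟨ sym (sF-split g L R L<M R≤M) ⟩
    sF (suc g) (L ++ M ∷ R)      ∎
    where open ≡.≡-Reasoning

s-split : ∀ L {M} R → All (_< M) L → All (_≤ M) R → s (L ++ M ∷ R) ≡ s L ++ s R ++ [ M ]
s-split L {M} R L<M R≤M with fuel-mid L R ≤-refl
... | f , |π|≡ , ≤L , ≤R = begin
  sF (length (L ++ M ∷ R)) (L ++ M ∷ R)  ≡⟨ cong (λ f → sF f (L ++ M ∷ R)) |π|≡ ⟩
  sF (suc f) (L ++ M ∷ R)                ≡⟨ sF-split f L R L<M R≤M ⟩
  sF f L ++ sF f R ++ [ M ]              ≡⟨ cong₂ (λ l r → l ++ r ++ [ M ]) (sF-fuel L ≤L ≤-refl) (sF-fuel R ≤R ≤-refl) ⟩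
  s L ++ s R ++ [ M ]                    ∎
  where open ≡.≡-Reasoning

s-↭ : ∀ π → s π ↭ π
s-↭ = max-induction (λ π → s π ↭ π) ↭-refl step
  where
  step : ∀ {L M R} → All (_< M) L → All (_≤ M) R → s L ↭ L → s R ↭ R → s (L ++ M ∷ R) ↭ L ++ M ∷ R
  step {L} {M} {R} L<M R≤M sL↭L sR↭R =
    subst (_↭ L ++ M ∷ R) (sym (s-split L R L<M R≤M)) (++⁺ sL↭L (↭-trans (++-comm (s R) [ M ]) (prep M sR↭R)))

s-All : ∀ {P : ℕ → Set} L → All P L → All P (s L)
s-All L = All-resp-↭ (↭-sym (s-↭ L))

iter-s-↭ : ∀ k π → iter k s π ↭ π
iter-s-↭ zero    π = ↭-refl
iter-s-↭ (suc k) π = ↭-trans (s-↭ (iter k s π)) (iter-s-↭ k π)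

iter-suc : ∀ j (f : List ℕ → List ℕ) x → iter (suc j) f x ≡ iter j f (f x)
iter-suc zero    f x = refl
iter-suc (suc j) f x = cong f (iter-suc j f x)

s-++-ascending : ∀ X {T} → Ascending T → X ≪ T → s (X ++ T) ≡ s X ++ T
s-++-ascending X {[]}    _            _    rewrite ++-identityʳ X | ++-identityʳ (s X) = refl
s-++-ascending X {t ∷ T} (t<T ∷ asc) X≪tT = begin
  s (X ++ t ∷ T)          ≡⟨ cong s (sym (++-assoc X [ t ] T)) ⟩
  s ((X ++ [ t ]) ++ T)   ≡⟨ s-++-ascending (X ++ [ t ]) asc (All.++⁺ (All.map All.tail X≪tT) (t<T ∷ [])) ⟩
  s (X ++ [ t ]) ++ T     ≡⟨ cong (_++ T) (s-split X [] (All.map All.head X≪tT) []) ⟩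
  (s X ++ [ t ]) ++ T     ≡⟨ ++-assoc (s X) [ t ] T ⟩
  s X ++ t ∷ T            ∎
  where open ≡.≡-Reasoning

s-ascending : ∀ {T} → Ascending T → s T ≡ T
s-ascending asc = s-++-ascending [] asc []

-- Entries above a threshold that are not descent tops

exceeds : ℕ → ℕ → ℕ
exceeds v e with v <? e
... | yes _ = 1
... | no  _ = 0

exceeds-yes : ∀ {v e} → v < e → exceeds v e ≡ 1
exceeds-yes {v} {e} v<e with v <? e
... | yes _   = refl
... | no  v≮e = ⊥-elim (v≮e v<e)

exceeds-no : ∀ {v e} → e ≤ v → exceeds v e ≡ 0
exceeds-no {v} {e} e≤v with v <? e
... | yes v<e = ⊥-elim (<⇒≱ v<e e≤v)
... | no  _   = refl

exceeds≤1 : ∀ v e → exceeds v e ≤ 1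
exceeds≤1 v e with v <? e
... | yes _ = ≤-refl
... | no  _ = z≤n

exceeds-antitone : ∀ {v w} e → v ≤ w → exceeds w e ≤ exceeds v e
exceeds-antitone {v} {w} e v≤w with w <? e
... | no  _   = z≤n
... | yes w<e = ≤-reflexive (sym (exceeds-yes (≤-<-trans v≤w w<e)))

ascentTop : ℕ → ℕ → ℕ → ℕ
ascentTop v e f with e ≤? f
... | yes _ = exceeds v e
... | no  _ = 0

ndt : ℕ → List ℕ → ℕ
ndt v []          = 0
ndt v (e ∷ [])    = exceeds v e
ndt v (e ∷ f ∷ r) = ascentTop v e f + ndt v (f ∷ r)

ascentTop≤exceeds : ∀ v e f → ascentTop v e f ≤ exceeds v e
ascentTop≤exceeds v e f with e ≤? f
... | yes _ = ≤-refl
... | no  _ = z≤n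

ascentTop-yes : ∀ v {e f} → e ≤ f → ascentTop v e f ≡ exceeds v e
ascentTop-yes v {e} {f} e≤f with e ≤? f
... | yes _   = refl
... | no  e≰f = ⊥-elim (e≰f e≤f)

ascentTop-no : ∀ v {e f} → f < e → ascentTop v e f ≡ 0
ascentTop-no v {e} {f} f<e with e ≤? f
... | yes e≤f = ⊥-elim (<⇒≱ f<e e≤f)
... | no  _   = refl

ascentTop-antitone : ∀ {v w} e f → v ≤ w → ascentTop w e f ≤ ascentTop v e f
ascentTop-antitone e f v≤w with e ≤? f
... | yes _ = exceeds-antitone e v≤w
... | no  _ = z≤n

ndt-antitone : ∀ {v w} P → v ≤ w → ndt w P ≤ ndt v P
ndt-antitone []          _   = z≤n
ndt-antitone (e ∷ [])    v≤w = exceeds-antitone e v≤w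
ndt-antitone (e ∷ f ∷ P) v≤w = +-mono-≤ (ascentTop-antitone e f v≤w) (ndt-antitone (f ∷ P) v≤w)

ndt-∷-≤ : ∀ v p Q → ndt v (p ∷ Q) ≤ exceeds v p + ndt v Q
ndt-∷-≤ v p []      = ≤-reflexive (sym (+-identityʳ _))
ndt-∷-≤ v p (q ∷ Q) = +-monoˡ-≤ _ (ascentTop≤exceeds v p q)

ndt-∷-≥ : ∀ v p Q → exceeds v p + ndt v Q ≤ suc (ndt v (p ∷ Q))
ndt-∷-≥ v p []      rewrite +-identityʳ (exceeds v p) = n≤1+n _
ndt-∷-≥ v p (q ∷ Q) with p ≤? q
... | yes _ = n≤1+n _
... | no  _ = +-monoˡ-≤ _ (exceeds≤1 v p)

ndt-++-≤ : ∀ v P Q → ndt v (P ++ Q) ≤ ndt v P + ndt v Q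
ndt-++-≤ v []          Q = ≤-refl
ndt-++-≤ v (p ∷ [])    Q = ndt-∷-≤ v p Q
ndt-++-≤ v (p ∷ p′ ∷ P) Q = begin
  ascentTop v p p′ + ndt v ((p′ ∷ P) ++ Q)        ≤⟨ +-monoʳ-≤ _ (ndt-++-≤ v (p′ ∷ P) Q) ⟩
  ascentTop v p p′ + (ndt v (p′ ∷ P) + ndt v Q)   ≡⟨ sym (+-assoc (ascentTop v p p′) _ _) ⟩
  ascentTop v p p′ + ndt v (p′ ∷ P) + ndt v Q     ∎
  where open ≤-Reasoning

ndt-++-≥ : ∀ v P Q → ndt v P + ndt v Q ≤ suc (ndt v (P ++ Q))
ndt-++-≥ v []          Q = n≤1+n _
ndt-++-≥ v (p ∷ [])    Q = ndt-∷-≥ v p Q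
ndt-++-≥ v (p ∷ p′ ∷ P) Q = begin
  ascentTop v p p′ + ndt v (p′ ∷ P) + ndt v Q       ≡⟨ +-assoc (ascentTop v p p′) _ _ ⟩
  ascentTop v p p′ + (ndt v (p′ ∷ P) + ndt v Q)     ≤⟨ +-monoʳ-≤ _ (ndt-++-≥ v (p′ ∷ P) Q) ⟩
  ascentTop v p p′ + suc (ndt v ((p′ ∷ P) ++ Q))    ≡⟨ +-suc _ _ ⟩
  suc (ascentTop v p p′ + ndt v ((p′ ∷ P) ++ Q))    ∎
  where open ≤-Reasoning

ndt-tail : ∀ v p Q → ndt v Q ≤ ndt v (p ∷ Q)
ndt-tail v p []      = z≤n
ndt-tail v p (q ∷ Q) = m≤n+m _ _

ndt-suffix : ∀ v P Q → ndt v Q ≤ ndt v (P ++ Q)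
ndt-suffix v []      Q = ≤-refl
ndt-suffix v (p ∷ P) Q = ≤-trans (ndt-suffix v P Q) (ndt-tail v p (P ++ Q))

ndt-≤ : ∀ v P → All (_≤ v) P → ndt v P ≡ 0
ndt-≤ v []          _          = refl
ndt-≤ v (p ∷ [])    (p≤v ∷ _)  = exceeds-no p≤v
ndt-≤ v (p ∷ q ∷ P) (p≤v ∷ ps) =
  cong₂ _+_ (n≤0⇒n≡0 (≤-trans (ascentTop≤exceeds v p q) (≤-reflexive (exceeds-no p≤v)))) (ndt-≤ v (q ∷ P) ps)

ndt-snoc : ∀ v P {M} → All (_≤ M) P → ndt v (P ++ [ M ]) ≡ ndt v P + exceeds v M
ndt-snoc v []          _           = refl
ndt-snoc v (p ∷ [])    (p≤M ∷ _)   = cong (_+ _) (ascentTop-yes v p≤M)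
ndt-snoc v (p ∷ q ∷ P) (_ ∷ P≤M)   =
  ≡.trans (cong (ascentTop v p q +_) (ndt-snoc v (q ∷ P) P≤M)) (sym (+-assoc (ascentTop v p q) _ _))

ndt-snoc-above : ∀ {v} P {M} → All (_≤ M) P → v < M → ndt v (P ++ [ M ]) ≡ suc (ndt v P)
ndt-snoc-above P P≤M v<M = ≡.trans (ndt-snoc _ P P≤M) (≡.trans (cong (_ +_) (exceeds-yes v<M)) (+-comm _ 1))

ndt-descent : ∀ v {M r} R → r < M → ndt v (M ∷ r ∷ R) ≡ ndt v (r ∷ R)
ndt-descent v R r<M = cong (_+ ndt v (_ ∷ R)) (ascentTop-no v r<M)

ndt-++-max : ∀ {v M} P Q → All (_≤ M) Q → v < M → ndt v P + ndt v Q ≤ ndt v (P ++ Q ++ [ M ])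
ndt-++-max {v} {M} P Q Q≤M v<M = ≤-pred (begin
  suc (ndt v P + ndt v Q)       ≡⟨ sym (+-suc (ndt v P) _) ⟩
  ndt v P + suc (ndt v Q)       ≡⟨ cong (ndt v P +_) (sym (ndt-snoc-above Q Q≤M v<M)) ⟩
  ndt v P + ndt v (Q ++ [ M ])  ≤⟨ ndt-++-≥ v P (Q ++ [ M ]) ⟩
  suc (ndt v (P ++ Q ++ [ M ])) ∎)
  where open ≤-Reasoning

s-bounded : ∀ {M} L → All (_< M) L → All (_≤ M) (s L)
s-bounded L L<M = s-All L (All.map <⇒≤ L<M)

ndt-s : ∀ v {π} → Unique π → ndt v π ≤ ndt v (s π)
ndt-s v = unique-max-induction (λ π → ndt v π ≤ ndt v (s π)) z≤n step
  where
  step : ∀ {L M R} → All (_< M) L → All (_< M) R → Unique L → Unique R →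
         ndt v L ≤ ndt v (s L) → ndt v R ≤ ndt v (s R) → ndt v (L ++ M ∷ R) ≤ ndt v (s (L ++ M ∷ R))
  step {L} {M} {R} L<M R<M _ _ ihL ihR rewrite s-split L R L<M (All.map <⇒≤ R<M) = bound R R<M ihR
    where
    open ≤-Reasoning
    bound : ∀ R → All (_< M) R → ndt v R ≤ ndt v (s R) → ndt v (L ++ M ∷ R) ≤ ndt v (s L ++ s R ++ [ M ])
    bound [] _ _ = begin
      ndt v (L ++ [ M ])         ≤⟨ ndt-++-≤ v L [ M ] ⟩
      ndt v L + exceeds v M      ≤⟨ +-monoˡ-≤ _ ihL ⟩
      ndt v (s L) + exceeds v M  ≡⟨ sym (ndt-snoc v (s L) (s-bounded L L<M)) ⟩
      ndt v (s L ++ [ M ])       ∎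
    bound (r ∷ R) R<M@(r<M ∷ _) ihR with v <? M
    ... | yes v<M = begin
      ndt v (L ++ M ∷ r ∷ R)                ≤⟨ ndt-++-≤ v L _ ⟩
      ndt v L + ndt v (M ∷ r ∷ R)           ≡⟨ cong (ndt v L +_) (ndt-descent v R r<M) ⟩
      ndt v L + ndt v (r ∷ R)               ≤⟨ +-mono-≤ ihL ihR ⟩
      ndt v (s L) + ndt v (s (r ∷ R))       ≤⟨ ndt-++-max (s L) (s (r ∷ R)) (s-bounded (r ∷ R) R<M) v<M ⟩
      ndt v (s L ++ s (r ∷ R) ++ [ M ])     ∎
    ... | no v≮M = begin
      ndt v (L ++ M ∷ r ∷ R)                ≤⟨ ndt-++-≤ v L _ ⟩
      ndt v L + ndt v (M ∷ r ∷ R)           ≡⟨ cong₂ _+_ (ndt-≤ v L L≤v) (ndt-descent v R r<M) ⟩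
      ndt v (r ∷ R)                         ≤⟨ ihR ⟩
      ndt v (s (r ∷ R))                     ≤⟨ m≤m+n _ _ ⟩
      ndt v (s (r ∷ R)) + exceeds v M       ≡⟨ sym (ndt-snoc v _ (s-bounded (r ∷ R) R<M)) ⟩
      ndt v (s (r ∷ R) ++ [ M ])            ≤⟨ ndt-suffix v (s L) _ ⟩
      ndt v (s L ++ s (r ∷ R) ++ [ M ])     ∎
      where
      L≤v : All (_≤ v) L
      L≤v = All.map (λ l<M → <⇒≤ (<-≤-trans l<M (≮⇒≥ v≮M))) L<M

data Adjacent++ (ys : List ℕ) (x z : ℕ) (zs A B : List ℕ) : Set where
  inLeft  : ∀ zs₁ → A ≡ ys ++ x ∷ z ∷ zs₁ → zs ≡ zs₁ ++ B → Adjacent++ ys x z zs A B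
  between : A ≡ ys ++ [ x ] → B ≡ z ∷ zs → Adjacent++ ys x z zs A B
  inRight : ∀ ys₂ → ys ≡ A ++ ys₂ → B ≡ ys₂ ++ x ∷ z ∷ zs → Adjacent++ ys x z zs A B

adjacent-++ : ∀ ys {x z} zs A {B} → ys ++ x ∷ z ∷ zs ≡ A ++ B → Adjacent++ ys x z zs A B
adjacent-++ ys       zs []           e    = inRight ys refl (sym e)
adjacent-++ []       zs (a ∷ [])     refl = between refl refl
adjacent-++ []       zs (a ∷ a′ ∷ A) refl = inLeft A refl refl
adjacent-++ (y ∷ ys) zs (a ∷ A)      e with ∷-injective e
... | refl , e′ with adjacent-++ ys zs A e′
...   | inLeft zs₁ A≡ zs≡    = inLeft zs₁ (cong (y ∷_) A≡) zs≡
...   | between A≡ B≡        = between (cong (y ∷_) A≡) B≡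
...   | inRight ys₂ ys≡ B≡   = inRight ys₂ (cong (y ∷_) ys≡) B≡

-- A descent x z of s σ, preceded by ys, comes from a descent x′ z′ of σ with a larger top. Going back from s σ
-- to σ, the ndt-count of the entries after the descent drops by at least one, and by two if x is not a
-- left-to-right maximum.
record DescentLift (σ ys : List ℕ) (x : ℕ) (rest : List ℕ) : Set where
  constructor lift
  field
    {ys′}  : List ℕ
    {x′ z′} : ℕ
    {zs′}  : List ℕ
    σ≡     : σ ≡ ys′ ++ x′ ∷ z′ ∷ zs′
    z′<x′  : z′ < x′
    x<x′   : x < x′
    gain   : suc (ndt x′ (z′ ∷ zs′)) ≤ ndt x rest
    gain₂  : Any (x <_) ys → Any (x′ <_) ys′ × 2 + ndt x′ (z′ ∷ zs′) ≤ ndt x rest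

s-last-max : ∀ L {ys x} → s L ≡ ys ++ [ x ] → All (_≤ x) ys
s-last-max []       {ys} {x} e with ++-conicalʳ ys [ x ] (sym e)
... | ()
s-last-max (l ∷ L′) {ys} e with max-split l L′
... | maxSplit {L} {M} {R} π≡ L<M R≤M with ∷ʳ-injective ys (s L ++ s R) (≡.trans (sym e) sπ)
  where
  sπ : s (l ∷ L′) ≡ (s L ++ s R) ++ [ M ]
  sπ = ≡.trans (cong s π≡) (≡.trans (s-split L R L<M R≤M) (sym (++-assoc (s L) (s R) [ M ])))
...   | refl , refl = All.++⁺ (s-bounded L L<M) (s-All R R≤M)

ndt-lift-bound : ∀ {x x′ M} c P P′ R → x < x′ → x < M → All (_≤ M) P → All (_< M) R → Unique R →
                 c + ndt x′ P′ ≤ ndt x P → c + ndt x′ (P′ ++ M ∷ R) ≤ ndt x (P ++ s R ++ [ M ])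
ndt-lift-bound {x} {x′} {M} c P P′ [] _ x<M P≤M _ _ h = begin
  c + ndt x′ (P′ ++ [ M ])          ≤⟨ +-monoʳ-≤ c (ndt-++-≤ x′ P′ [ M ]) ⟩
  c + (ndt x′ P′ + exceeds x′ M)    ≤⟨ +-monoʳ-≤ c (+-monoʳ-≤ _ (exceeds≤1 x′ M)) ⟩
  c + (ndt x′ P′ + 1)               ≡⟨ ≡.trans (cong (c +_) (+-comm _ 1)) (+-suc c _) ⟩
  suc (c + ndt x′ P′)               ≤⟨ s≤s h ⟩
  suc (ndt x P)                     ≡⟨ sym (ndt-snoc-above P P≤M x<M) ⟩
  ndt x (P ++ [ M ])                ∎
  where open ≤-Reasoning
ndt-lift-bound {x} {x′} {M} c P P′ (r ∷ R) x<x′ x<M P≤M R<M@(r<M ∷ _) uR h = begin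
  c + ndt x′ (P′ ++ M ∷ r ∷ R)         ≤⟨ +-monoʳ-≤ c (ndt-++-≤ x′ P′ _) ⟩
  c + (ndt x′ P′ + ndt x′ (M ∷ r ∷ R)) ≡⟨ cong (λ n → c + (ndt x′ P′ + n)) (ndt-descent x′ R r<M) ⟩
  c + (ndt x′ P′ + ndt x′ (r ∷ R))     ≡⟨ sym (+-assoc c _ _) ⟩
  c + ndt x′ P′ + ndt x′ (r ∷ R)       ≤⟨ +-mono-≤ h (≤-trans (ndt-antitone (r ∷ R) (<⇒≤ x<x′)) (ndt-s x uR)) ⟩
  ndt x P + ndt x (s (r ∷ R))          ≤⟨ ndt-++-max P (s (r ∷ R)) (s-bounded (r ∷ R) R<M) x<M ⟩
  ndt x (P ++ s (r ∷ R) ++ [ M ])      ∎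
  where open ≤-Reasoning

lift-left : ∀ {L M R} → All (_< M) L → All (_< M) R → Unique R → ∀ {ys x z zs₁} →
            s L ≡ ys ++ x ∷ z ∷ zs₁ → DescentLift L ys x (z ∷ zs₁) →
            DescentLift (L ++ M ∷ R) ys x (z ∷ zs₁ ++ s R ++ [ M ])
lift-left {L} {M} {R} L<M R<M uR {ys} {x} {z} {zs₁} sL≡ (lift {ys′} {x′} {z′} {zs′} L≡ z′<x′ x<x′ gain gain₂) =
  lift σ≡ z′<x′ x<x′ (bound 1 gain) (λ any → proj₁ (gain₂ any) , bound 2 (proj₂ (gain₂ any)))
  where
  sL≤M : All (_≤ M) (ys ++ x ∷ z ∷ zs₁)
  sL≤M = subst (All (_≤ M)) sL≡ (All.map <⇒≤ (s-All L L<M))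
  x<M : x < M
  x<M = All.lookup (s-All L L<M) (subst (x ∈_) (sym sL≡) (∈-insert ys))
  σ≡ : L ++ M ∷ R ≡ ys′ ++ x′ ∷ z′ ∷ zs′ ++ M ∷ R
  σ≡ = ≡.trans (cong (_++ M ∷ R) L≡) (++-assoc ys′ _ (M ∷ R))
  bound : ∀ c → c + ndt x′ (z′ ∷ zs′) ≤ ndt x (z ∷ zs₁) →
          c + ndt x′ (z′ ∷ zs′ ++ M ∷ R) ≤ ndt x (z ∷ zs₁ ++ s R ++ [ M ])
  bound c = ndt-lift-bound c (z ∷ zs₁) (z′ ∷ zs′) R x<x′ x<M (All.tail (All.++⁻ʳ ys sL≤M)) R<M uR

lift-max : ∀ {L M R} → All (_< M) L → All (_< M) R → ∀ {ys x z zs} →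
           s L ≡ ys ++ [ x ] → s R ++ [ M ] ≡ z ∷ zs → z < x → DescentLift (L ++ M ∷ R) ys x (z ∷ zs)
lift-max {L} {M} {R} L<M R<M {ys} {x} {z} {zs} sL≡ sR≡ z<x = go R R<M sR≡
  where
  x<M : x < M
  x<M = All.lookup (s-All L L<M) (subst (x ∈_) (sym sL≡) (∈-insert ys))
  go : ∀ R → All (_< M) R → s R ++ [ M ] ≡ z ∷ zs → DescentLift (L ++ M ∷ R) ys x (z ∷ zs)
  go []       _                 M≡ = ⊥-elim (<-asym x<M (subst (_< x) (sym (proj₁ (∷-injective M≡))) z<x))
  go (r ∷ R′) R<M@(r<M ∷ R′<M) sR≡ = lift refl r<M x<M gain
    (λ any → ⊥-elim (All¬⇒¬Any (All.map ≤⇒≯ (s-last-max L sL≡)) any))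
    where
    open ≤-Reasoning
    gain : suc (ndt M (r ∷ R′)) ≤ ndt x (z ∷ zs)
    gain = begin
      suc (ndt M (r ∷ R′))          ≡⟨ cong suc (ndt-≤ M (r ∷ R′) (All.map <⇒≤ R<M)) ⟩
      1                             ≤⟨ s≤s z≤n ⟩
      suc (ndt x (s (r ∷ R′)))      ≡⟨ sym (ndt-snoc-above (s (r ∷ R′)) (s-bounded (r ∷ R′) R<M) x<M) ⟩
      ndt x (s (r ∷ R′) ++ [ M ])   ≡⟨ cong (ndt x) sR≡ ⟩
      ndt x (z ∷ zs)                ∎

lift-right : ∀ L {M R} → All (_< M) R → ∀ {ys₂ x z zs₁} →
             s R ≡ ys₂ ++ x ∷ z ∷ zs₁ → DescentLift R ys₂ x (z ∷ zs₁) →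
             ∀ ys → DescentLift (L ++ M ∷ R) ys x (z ∷ zs₁ ++ [ M ])
lift-right L {M} {R} R<M {ys₂} {x} {z} {zs₁} sR≡ (lift {ys′} {x′} {z′} {zs′} R≡ z′<x′ x<x′ gain _) ys =
  lift σ≡ z′<x′ x<x′ (≤-trans gain (≤-trans (n≤1+n _) (≤-reflexive rest≡)))
       (λ _ → Any.++⁺ʳ L (here x′<M) , ≤-trans (s≤s gain) (≤-reflexive rest≡))
  where
  sR<M : All (_< M) (ys₂ ++ x ∷ z ∷ zs₁)
  sR<M = subst (All (_< M)) sR≡ (s-All R R<M)
  x′<M : x′ < M
  x′<M = All.lookup R<M (subst (x′ ∈_) (sym R≡) (∈-insert ys′))
  rest≡ : suc (ndt x (z ∷ zs₁)) ≡ ndt x (z ∷ zs₁ ++ [ M ])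
  rest≡ = sym (ndt-snoc-above (z ∷ zs₁) (All.map <⇒≤ (All.tail (All.++⁻ʳ ys₂ sR<M)))
                              (All.head (All.++⁻ʳ ys₂ sR<M)))
  σ≡ : L ++ M ∷ R ≡ (L ++ M ∷ ys′) ++ x′ ∷ z′ ∷ zs′
  σ≡ = ≡.trans (cong (λ R → L ++ M ∷ R) R≡) (sym (++-assoc L (M ∷ ys′) _))

descent-lift : ∀ {σ} → Unique σ → ∀ ys {x z} zs → s σ ≡ ys ++ x ∷ z ∷ zs → z < x → DescentLift σ ys x (z ∷ zs)
descent-lift = unique-max-induction _ (λ ys {x} {z} zs e _ → ⊥-elim ([]≢ ys e)) step
  where
  []≢ : ∀ ys {x z zs} → [] ≢ ys ++ x ∷ z ∷ zs
  []≢ []      ()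
  []≢ (_ ∷ _) ()
  [_]≢ : ∀ M ys {x z zs} → [ M ] ≢ ys ++ x ∷ z ∷ zs
  [ M ]≢ []          ()
  [ M ]≢ (_ ∷ [])    ()
  [ M ]≢ (_ ∷ _ ∷ _) ()
  step : ∀ {L M R} → All (_< M) L → All (_< M) R → Unique L → Unique R →
         (∀ ys {x z} zs → s L ≡ ys ++ x ∷ z ∷ zs → z < x → DescentLift L ys x (z ∷ zs)) →
         (∀ ys {x z} zs → s R ≡ ys ++ x ∷ z ∷ zs → z < x → DescentLift R ys x (z ∷ zs)) →
         ∀ ys {x z} zs → s (L ++ M ∷ R) ≡ ys ++ x ∷ z ∷ zs → z < x → DescentLift (L ++ M ∷ R) ys x (z ∷ zs)
  step {L} {M} {R} L<M R<M _ uR ihL ihR ys zs e z<x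
    with adjacent-++ ys zs (s L) (≡.trans (sym e) (s-split L R L<M (All.map <⇒≤ R<M)))
  ... | inLeft zs₁ sL≡ refl = lift-left L<M R<M uR sL≡ (ihL ys zs₁ sL≡ z<x)
  ... | between sL≡ sR≡     = lift-max L<M R<M sL≡ sR≡ z<x
  ... | inRight ys₂ refl sR≡ with adjacent-++ ys₂ zs (s R) (sym sR≡)
  ...   | inLeft zs₁ sR≡′ refl = lift-right L R<M sR≡′ (ihR ys₂ zs₁ sR≡′ z<x) (s L ++ ys₂)
  ...   | between sR≡′ refl    = ⊥-elim (<-asym z<x (All.lookup (s-All R R<M)
                                                               (subst (_ ∈_) (sym sR≡′) (∈-insert ys₂))))
  ...   | inRight ys₃ _ M≡     = ⊥-elim ([ M ]≢ ys₃ M≡)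

iter-s-descent-ndt : ∀ k {σ} → Unique σ → ∀ ys {x z} zs → iter k s σ ≡ ys ++ x ∷ z ∷ zs → z < x →
                     Any (x <_) ys → k + k ≤ ndt x (z ∷ zs)
iter-s-descent-ndt zero    _  _  _  _ _   _   = z≤n
iter-s-descent-ndt (suc k) {σ} uσ ys zs e z<x x<ys
  with descent-lift (Unique-resp-↭ (↭-sym (iter-s-↭ k σ)) uσ) ys zs e z<x
... | lift {ys′} {x′} {z′} {zs′} σ≡ z′<x′ _ _ gain₂ with gain₂ x<ys
...   | x′<ys′ , bound = begin
  suc k + suc k                 ≡⟨ cong suc (+-suc k k) ⟩
  2 + (k + k)                   ≤⟨ s≤s (s≤s (iter-s-descent-ndt k uσ ys′ zs′ σ≡ z′<x′ x′<ys′)) ⟩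
  2 + ndt x′ (z′ ∷ zs′)         ≤⟨ bound ⟩
  ndt _ (_ ∷ zs)                ∎
  where open ≤-Reasoning

-- Intervals and permutations of [n]

interval : ℕ → ℕ → List ℕ
interval a zero    = []
interval a (suc j) = suc a ∷ interval (suc a) j

applyUpTo-interval : ∀ (f : ℕ → ℕ) a j → (∀ i → f i ≡ suc (a + i)) → applyUpTo f j ≡ interval a j
applyUpTo-interval f a zero    _  = refl
applyUpTo-interval f a (suc j) f≗ = cong₂ _∷_ (≡.trans (f≗ 0) (cong suc (+-identityʳ a)))
  (applyUpTo-interval (f ∘ suc) (suc a) j (λ i → ≡.trans (f≗ (suc i)) (cong suc (+-suc a i))))

range1≡interval : ∀ n → range1 n ≡ interval 0 n
range1≡interval n = ≡.trans (map-upTo suc n) (applyUpTo-interval suc 0 n (λ _ → refl))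

interval-++ : ∀ a j k → interval a (j + k) ≡ interval a j ++ interval (j + a) k
interval-++ a zero    k = refl
interval-++ a (suc j) k = cong (suc a ∷_) (≡.trans (interval-++ (suc a) j k) (cong (λ b → interval (suc a) j ++ interval b k) (+-suc j a)))

interval-snoc : ∀ a j → interval a (suc j) ≡ interval a j ++ [ suc (j + a) ]
interval-snoc a j = ≡.trans (cong (interval a) (+-comm 1 j)) (interval-++ a j 1)

length-interval : ∀ a j → length (interval a j) ≡ j
length-interval a zero    = refl
length-interval a (suc j) = cong suc (length-interval (suc a) j)

∈-interval⁻ : ∀ {x} a j → x ∈ interval a j → a < x × x ≤ j + a
∈-interval⁻ a (suc j) (here refl) = ≤-refl , s≤s (m≤n+m a j)
∈-interval⁻ a (suc j) (there x∈) with ∈-interval⁻ (suc a) j x∈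
... | a<x , x≤ = <-trans (n<1+n a) a<x , ≤-trans x≤ (≤-reflexive (+-suc j a))

∈-interval⁺ : ∀ {x} a j → a < x → x ≤ j + a → x ∈ interval a j
∈-interval⁺     a zero    a<x x≤a = ⊥-elim (<⇒≱ a<x x≤a)
∈-interval⁺ {x} a (suc j) a<x x≤ with x ≟ suc a
... | yes refl = here refl
... | no  x≢   = there (∈-interval⁺ (suc a) j (≤∧≢⇒< a<x (≢-sym x≢)) (≤-trans x≤ (≤-reflexive (sym (+-suc j a)))))

interval-above : ∀ a j → All (a <_) (interval a j)
interval-above a j = All.tabulate (λ x∈ → proj₁ (∈-interval⁻ a j x∈))

interval-ascending : ∀ a j → Ascending (interval a j)
interval-ascending a zero    = []
interval-ascending a (suc j) = interval-above (suc a) j ∷ interval-ascending (suc a) j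

range1-suc : ∀ n → range1 (suc n) ≡ range1 n ++ [ suc n ]
range1-suc n = ≡.trans (cong (map suc) (sym (upTo-∷ʳ n))) (map-++ suc (upTo n) [ n ])

∈-range1⁻ : ∀ {x} n → x ∈ range1 n → 0 < x × x ≤ n
∈-range1⁻ {x} n x∈ with ∈-interval⁻ 0 n (subst (x ∈_) (range1≡interval n) x∈)
... | 0<x , x≤ = 0<x , subst (x ≤_) (+-identityʳ n) x≤

∈-range1⁺ : ∀ {x} n → 0 < x → x ≤ n → x ∈ range1 n
∈-range1⁺ {x} n 0<x x≤n =
  subst (x ∈_) (sym (range1≡interval n)) (∈-interval⁺ 0 n 0<x (subst (x ≤_) (sym (+-identityʳ n)) x≤n))

range1-unique : ∀ n → Unique (range1 n)
range1-unique n = subst Unique (sym (range1≡interval n)) (Ascending⇒Unique (interval-ascending 0 n))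

length-range1 : ∀ n → length (range1 n) ≡ n
length-range1 n = ≡.trans (length-map suc (upTo n)) (length-upTo n)

module _ {n π} (π↭ : π ↭ range1 n) where

  perm-unique : Unique π
  perm-unique = Unique-resp-↭ (↭-sym π↭) (range1-unique n)

  perm-∈⁻ : ∀ {x} → x ∈ π → 0 < x × x ≤ n
  perm-∈⁻ x∈ = ∈-range1⁻ n (∈-resp-↭ π↭ x∈)

  perm-∈⁺ : ∀ {x} → 0 < x → x ≤ n → x ∈ π
  perm-∈⁺ 0<x x≤n = ∈-resp-↭ (↭-sym π↭) (∈-range1⁺ n 0<x x≤n)

  perm-bounded : All (_≤ n) π
  perm-bounded = All.tabulate (proj₂ ∘ perm-∈⁻)

perm-from-∈ : ∀ n {π} → Unique π → (∀ {x} → x ∈ π → 0 < x × x ≤ n) → (∀ {x} → 0 < x → x ≤ n → x ∈ π) → π ↭ range1 n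
perm-from-∈ n uπ ⊆ ⊇ = Unique⇒↭ uπ (range1-unique n)
  (λ x∈ → ∈-range1⁺ n (proj₁ (⊆ x∈)) (proj₂ (⊆ x∈))) (λ x∈ → ⊇ (proj₁ (∈-range1⁻ n x∈)) (proj₂ (∈-range1⁻ n x∈)))

range1-+ : ∀ m t → range1 (t + m) ≡ range1 m ++ interval m t
range1-+ m t = begin
  range1 (t + m)               ≡⟨ cong range1 (+-comm t m) ⟩
  range1 (m + t)               ≡⟨ ≡.trans (range1≡interval (m + t)) (interval-++ 0 m t) ⟩
  interval 0 m ++ interval (m + 0) t ≡⟨ cong₂ (λ xs a → xs ++ interval a t) (sym (range1≡interval m)) (+-identityʳ m) ⟩
  range1 m ++ interval m t        ∎
  where open ≡.≡-Reasoning

-- Tails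

iter-s-tail : ∀ k {b σ} → σ ↭ range1 (k + b) → ∃[ β ] β ↭ range1 b × iter k s σ ≡ β ++ interval b k
iter-s-tail zero    {b} {σ} σ↭ = σ , σ↭ , sym (++-identityʳ σ)
iter-s-tail (suc k) {b} {σ} σ↭ with iter-s-tail k (subst (λ n → σ ↭ range1 n) (sym (+-suc k b)) σ↭)
... | β′ , β′↭ , e with ∈-∃++ (perm-∈⁺ β′↭ (s≤s z≤n) ≤-refl)
...   | L , R , refl = s L ++ s R , β↭ , iter≡
  where
  T = interval (suc b) k
  L<M : All (_< suc b) L
  L<M = All.tabulate (λ l∈ → ≤∧≢⇒< (All.lookup (perm-bounded β′↭) (∈-++⁺ˡ l∈))
                                   (λ { refl → proj₁ (Unique-mid-∉ L (perm-unique β′↭)) l∈ }))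
  R≤M : All (_≤ suc b) R
  R≤M = All.tail (All.++⁻ʳ L (perm-bounded β′↭))
  β↭ : s L ++ s R ↭ range1 b
  β↭ = ↭-trans (++⁺ (s-↭ L) (s-↭ R))
               (subst (L ++ R ↭_) (++-identityʳ (range1 b))
                      (drop-mid L (range1 b) (subst (L ++ suc b ∷ R ↭_) (range1-suc b) β′↭)))
  β′≪T : (L ++ suc b ∷ R) ≪ T
  β′≪T = All.map (λ x≤ → All.map (≤-<-trans x≤) (interval-above (suc b) k)) (perm-bounded β′↭)
  iter≡ : s (iter k s σ) ≡ (s L ++ s R) ++ interval b (suc k)
  iter≡ = begin
    s (iter k s σ)                  ≡⟨ cong s e ⟩
    s ((L ++ suc b ∷ R) ++ T)       ≡⟨ s-++-ascending (L ++ suc b ∷ R) (interval-ascending (suc b) k) β′≪T ⟩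
    s (L ++ suc b ∷ R) ++ T         ≡⟨ cong (_++ T) (s-split L R L<M R≤M) ⟩
    (s L ++ s R ++ [ suc b ]) ++ T  ≡⟨ ++-assoc (s L) _ T ⟩
    s L ++ (s R ++ [ suc b ]) ++ T  ≡⟨ cong (s L ++_) (++-assoc (s R) _ T) ⟩
    s L ++ s R ++ suc b ∷ T         ≡⟨ sym (++-assoc (s L) (s R) _) ⟩
    (s L ++ s R) ++ suc b ∷ T       ∎
    where open ≡.≡-Reasoning

reverse-interval-suc : ∀ a j → reverse (interval a (suc j)) ≡ suc (j + a) ∷ reverse (interval a j)
reverse-interval-suc a j = ≡.trans (cong reverse (interval-snoc a j)) (reverse-++ (interval a j) [ suc (j + a) ])

tlGo-interval⁺ : ∀ j a xs → j ≤ tlGo (j + a) (reverse (interval a j) ++ xs)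
tlGo-interval⁺ zero    a xs = z≤n
tlGo-interval⁺ (suc j) a xs rewrite reverse-interval-suc a j | dec-true (suc (j + a) ≟ suc (j + a)) refl =
  s≤s (tlGo-interval⁺ j a xs)

tlGo-interval⁻ : ∀ j a xs → j ≤ tlGo (j + a) xs → ∃[ ys ] xs ≡ reverse (interval a j) ++ ys
tlGo-interval⁻ zero    a xs       _ = xs , refl
tlGo-interval⁻ (suc j) a []       ()
tlGo-interval⁻ (suc j) a (x ∷ xs) j<tl with x ≟ suc (j + a)
... | no x≢ rewrite dec-false (x ≟ suc (j + a)) x≢ with j<tl
...   | ()
tlGo-interval⁻ (suc j) a (x ∷ xs) j<tl | yes refl rewrite dec-true (x ≟ x) refl with tlGo-interval⁻ j a xs (≤-pred j<tl)
... | ys , refl = ys , cong (_++ ys) (sym (reverse-interval-suc a j))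

tl-interval⁺ : ∀ j a β → j ≤ tl (j + a) (β ++ interval a j)
tl-interval⁺ j a β rewrite reverse-++ β (interval a j) = tlGo-interval⁺ j a (reverse β)

tl-interval⁻ : ∀ j a π → j ≤ tl (j + a) π → ∃[ β ] π ≡ β ++ interval a j
tl-interval⁻ j a π j≤ with tlGo-interval⁻ j a (reverse π) j≤
... | ys , e = reverse ys , (begin
  π                                        ≡⟨ sym (reverse-involutive π) ⟩
  reverse (reverse π)                      ≡⟨ cong reverse e ⟩
  reverse (reverse (interval a j) ++ ys)      ≡⟨ reverse-++ (reverse (interval a j)) ys ⟩
  reverse ys ++ reverse (reverse (interval a j)) ≡⟨ cong (reverse ys ++_) (reverse-involutive (interval a j)) ⟩
  reverse ys ++ interval a j                  ∎)
  where open ≡.≡-Reasoning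

#above : ℕ → List ℕ → ℕ
#above x P = length (filter (x <?_) P)

#above-∷ : ∀ x e P → #above x (e ∷ P) ≡ exceeds x e + #above x P
#above-∷ x e P with x <? e
... | yes x<e rewrite dec-true (x <? e) x<e = refl
... | no  x≮e rewrite dec-false (x <? e) x≮e = refl

#above-++ : ∀ x P Q → #above x (P ++ Q) ≡ #above x P + #above x Q
#above-++ x P Q = ≡.trans (cong length (filter-++ (x <?_) P Q)) (length-++ (filter (x <?_) P))

#above-↭ : ∀ x {P Q} → P ↭ Q → #above x P ≡ #above x Q
#above-↭ x P↭Q = ↭-length (filter-↭ (x <?_) P↭Q)

#above-range1 : ∀ x j → #above x (range1 (x + j)) ≡ j
#above-range1 x j = begin
  #above x (range1 (x + j))                    ≡⟨ cong (#above x) (≡.trans (range1≡interval (x + j)) (interval-++ 0 x j)) ⟩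
  #above x (interval 0 x ++ interval (x + 0) j)      ≡⟨ #above-++ x (interval 0 x) _ ⟩
  #above x (interval 0 x) + #above x (interval (x + 0) j)
    ≡⟨ cong₂ _+_ (cong length (filter-none (x <?_) (All.tabulate (λ y∈ → ≤⇒≯ (subst (_ ≤_) (+-identityʳ x) (proj₂ (∈-interval⁻ 0 x y∈)))))))
                 (cong length (filter-all (x <?_) (subst (λ a → All (a <_) (interval (x + 0) j)) (+-identityʳ x) (interval-above _ j)))) ⟩
  length (interval (x + 0) j)                     ≡⟨ length-interval _ j ⟩
  j                                            ∎
  where open ≡.≡-Reasoning

ndt≤#above : ∀ x P → ndt x P ≤ #above x P
ndt≤#above x []          = z≤n
ndt≤#above x (e ∷ [])    = ≤-trans (m≤m+n _ 0) (≤-reflexive (sym (#above-∷ x e [])))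
ndt≤#above x (e ∷ f ∷ P) = ≤-trans (+-mono-≤ (ascentTop≤exceeds x e f) (ndt≤#above x (f ∷ P)))
                                   (≤-reflexive (sym (#above-∷ x e (f ∷ P))))

ndt≤length : ∀ x P → ndt x P ≤ length P
ndt≤length x P = ≤-trans (ndt≤#above x P) (length-filter (x <?_) P)

Any-above : ∀ x ys → Any (x <_) ys → 1 ≤ #above x ys
Any-above x (y ∷ ys) (here x<y)  rewrite #above-∷ x y ys | exceeds-yes x<y = s≤s z≤n
Any-above x (y ∷ ys) (there any) rewrite #above-∷ x y ys = ≤-trans (Any-above x ys any) (m≤n+m _ _)

ndt-full⇒ascending : ∀ v P → Unique P → length P ≤ ndt v P → Ascending P
ndt-full⇒ascending v []          _               _ = []
ndt-full⇒ascending v (e ∷ [])    _               _ = [] ∷ []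
ndt-full⇒ascending v (e ∷ f ∷ P) ((e≢f ∷ _) ∷ u) full with f <? e
... | yes f<e = ⊥-elim (<-irrefl refl (≤-trans full (≤-trans (≤-reflexive (cong (_+ _) (ascentTop-no v f<e)))
                                                             (ndt≤length v (f ∷ P)))))
... | no  f≮e = (e<f ∷ All.map (<-trans e<f) (AllPairs.head asc)) ∷ asc
  where
  e<f : e < f
  e<f = ≤∧≢⇒< (≮⇒≥ f≮e) e≢f
  asc : Ascending (f ∷ P)
  asc = ndt-full⇒ascending v (f ∷ P) u
          (≤-pred (≤-trans full (+-monoˡ-≤ _ (≤-trans (ascentTop≤exceeds v e f) (exceeds≤1 v e)))))

-- The permutations ζ

zetaTail : ℕ → ℕ → List ℕ
zetaTail ℓ m = filter (λ x → ¬? (x ≟ ℓ)) (map (λ i → i + 3) (upTo (2 * m ∸ 5)))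

t+[3+t] : ∀ t → t + (3 + t) ≡ 3 + (t + t)
t+[3+t] t = ≡.trans (+-suc t _) (cong suc (≡.trans (+-suc t _) (cong suc (+-suc t t))))

2m∸3≡ : ∀ t → 2 * (3 + t) ∸ 3 ≡ t + (3 + t)
2m∸3≡ t = cong (t +_) (+-identityʳ (3 + t))

zetaTail≡ : ∀ t ℓ → zetaTail ℓ (3 + t) ≡ filter (λ x → ¬? (x ≟ ℓ)) (interval 2 (suc (t + t)))
zetaTail≡ t ℓ = cong (filter _) (≡.trans (map-upTo _ K)
  (≡.trans (applyUpTo-interval _ 2 K (λ i → +-comm i 3)) (cong (interval 2) K≡)))
  where
  K = 2 * (3 + t) ∸ 5
  K≡ : K ≡ suc (t + t)
  K≡ = cong (_∸ 2) (≡.trans (2m∸3≡ t) (t+[3+t] t))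

∈-zetaTail⁻ : ∀ t {ℓ z} → z ∈ zetaTail ℓ (3 + t) → 2 < z × z ≤ t + (3 + t) × z ≢ ℓ
∈-zetaTail⁻ t {ℓ} {z} z∈ with ∈-filter⁻ (λ x → ¬? (x ≟ ℓ)) (subst (z ∈_) (zetaTail≡ t ℓ) z∈)
... | z∈interval , z≢ℓ with ∈-interval⁻ 2 (suc (t + t)) z∈interval
...   | 2<z , z≤ = 2<z , ≤-trans z≤ (≤-reflexive (≡.trans (+-comm _ 2) (sym (t+[3+t] t)))) , z≢ℓ

∈-zetaTail⁺ : ∀ t {ℓ z} → 2 < z → z ≤ t + (3 + t) → z ≢ ℓ → z ∈ zetaTail ℓ (3 + t)
∈-zetaTail⁺ t {ℓ} {z} 2<z z≤ z≢ℓ = subst (z ∈_) (sym (zetaTail≡ t ℓ))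
  (∈-filter⁺ (λ x → ¬? (x ≟ ℓ)) (∈-interval⁺ 2 _ 2<z (≤-trans z≤ (≤-reflexive (≡.trans (t+[3+t] t) (+-comm 2 _))))) z≢ℓ)

zetaTail-ascending : ∀ t ℓ → Ascending (zetaTail ℓ (3 + t))
zetaTail-ascending t ℓ = subst Ascending (sym (zetaTail≡ t ℓ))
  (AllPairs.filter⁺ (λ x → ¬? (x ≟ ℓ)) (interval-ascending 2 (suc (t + t))))

beyond-1-2 : ∀ {w} → 0 < w → w ≢ 1 → w ≢ 2 → 2 < w
beyond-1-2 {1}           _ w≢1 _   = ⊥-elim (w≢1 refl)
beyond-1-2 {2}           _ _   w≢2 = ⊥-elim (w≢2 refl)
beyond-1-2 {suc (suc (suc w))} _ _ _ = s≤s (s≤s (s≤s z≤n))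

zeta-perm : ∀ t {ℓ} → 3 ≤ ℓ → ℓ ≤ t + (3 + t) → zeta ℓ (3 + t) ↭ range1 (t + (3 + t))
zeta-perm t {ℓ} 3≤ℓ ℓ≤N = perm-from-∈ N unique ⊆ ⊇
  where
  N = t + (3 + t)
  Z = zetaTail ℓ (3 + t)
  3≤N : 3 ≤ N
  3≤N = ≤-trans (s≤s (s≤s (s≤s z≤n))) (≤-reflexive (sym (t+[3+t] t)))
  unique : Unique (ℓ ∷ 2 ∷ 1 ∷ Z)
  unique = ((λ { refl → <-irrefl refl 3≤ℓ }) ∷ (λ { refl → <-asym 3≤ℓ (s≤s (s≤s z≤n)) })
              ∷ All.tabulate (λ z∈ → ≢-sym (proj₂ (proj₂ (∈-zetaTail⁻ t z∈)))))
         ∷ ((λ ()) ∷ All.tabulate (λ z∈ 2≡ → <-irrefl 2≡ (proj₁ (∈-zetaTail⁻ t z∈))))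
         ∷ All.tabulate (λ z∈ 1≡ → ≤⇒≯ (s≤s z≤n) (subst (2 <_) (sym 1≡) (proj₁ (∈-zetaTail⁻ t z∈))))
         ∷ Ascending⇒Unique (zetaTail-ascending t ℓ)
  ⊆ : ∀ {x} → x ∈ ℓ ∷ 2 ∷ 1 ∷ Z → 0 < x × x ≤ N
  ⊆ (here refl)                 = ≤-trans (s≤s z≤n) 3≤ℓ , ℓ≤N
  ⊆ (there (here refl))         = s≤s z≤n , ≤-trans (n≤1+n 2) 3≤N
  ⊆ (there (there (here refl))) = s≤s z≤n , ≤-trans (s≤s z≤n) 3≤N
  ⊆ (there (there (there x∈)))  with ∈-zetaTail⁻ t x∈
  ... | 2<x , x≤N , _ = <-trans (s≤s z≤n) 2<x , x≤N
  ⊇ : ∀ {x} → 0 < x → x ≤ N → x ∈ ℓ ∷ 2 ∷ 1 ∷ Z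
  ⊇ {x} 0<x x≤N with x ≟ ℓ | x ≟ 2 | x ≟ 1
  ... | yes refl | _        | _        = here refl
  ... | no  _    | yes refl | _        = there (here refl)
  ... | no  _    | no _     | yes refl = there (there (here refl))
  ... | no  x≢ℓ  | no x≢2   | no x≢1   = there (there (there (∈-zetaTail⁺ t (beyond-1-2 0<x x≢1 x≢2) x≤N x≢ℓ)))

zeta-completion : ∀ t {ℓ zs} → ℓ ∷ 2 ∷ 1 ∷ zs ↭ range1 (t + (3 + t)) → Ascending zs → zs ≡ zetaTail ℓ (3 + t)
zeta-completion t {ℓ} {zs} π↭ asc = Ascending-determined asc (zetaTail-ascending t ℓ) ⊆ ⊇
  where
  u = perm-unique π↭
  ⊆ : ∀ {z} → z ∈ zs → z ∈ zetaTail ℓ (3 + t)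
  ⊆ z∈ with perm-∈⁻ π↭ (there (there (there z∈)))
  ... | 0<z , z≤N = ∈-zetaTail⁺ t (beyond-1-2 0<z (λ { refl → All.lookup (AllPairs.head (AllPairs.tail (AllPairs.tail u))) z∈ refl })
                                             (λ { refl → All.lookup (All.tail (AllPairs.head (AllPairs.tail u))) z∈ refl }))
                                  z≤N (λ { refl → All.lookup (All.tail (All.tail (AllPairs.head u))) z∈ refl })
  ⊇ : ∀ {z} → z ∈ zetaTail ℓ (3 + t) → z ∈ zs
  ⊇ z∈ with ∈-zetaTail⁻ t z∈
  ... | 2<z , z≤N , z≢ℓ with perm-∈⁺ π↭ (<-trans (s≤s z≤n) 2<z) z≤N
  ...   | here z≡ℓ                  = ⊥-elim (z≢ℓ z≡ℓ)
  ...   | there (here refl)         = ⊥-elim (<-irrefl refl 2<z)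
  ...   | there (there (here refl)) = ⊥-elim (≤⇒≯ (s≤s z≤n) 2<z)
  ...   | there (there (there z∈zs)) = z∈zs

zeta? : ∀ m π → Dec (Σ ℕ λ ℓ → 3 ≤ ℓ × ℓ ≤ m × π ≡ zeta ℓ m)
zeta? m []      = no λ { (_ , _ , _ , ()) }
zeta? m (ℓ ∷ π) with 3 ≤? ℓ | ℓ ≤? m | ≡-dec _≟_ (ℓ ∷ π) (zeta ℓ m)
... | yes 3≤ℓ | yes ℓ≤m | yes π≡ = yes (ℓ , 3≤ℓ , ℓ≤m , π≡)
... | no  3≰ℓ | _       | _      = no λ { (_ , 3≤ℓ′ , _ , refl) → 3≰ℓ 3≤ℓ′ }
... | yes _   | no  ℓ≰m | _      = no λ { (_ , _ , ℓ≤m′ , refl) → ℓ≰m ℓ≤m′ }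
... | yes _   | yes _   | no  π≢ = no λ { (_ , _ , _ , refl) → π≢ refl }

-- Descent tops in s^t(S_{2t+3})

module _ (t : ℕ) {σ} (σ↭ : σ ↭ range1 (t + (3 + t))) where

  private
    N = t + (3 + t)
    π↭ : iter t s σ ↭ range1 N
    π↭ = ↭-trans (iter-s-↭ t σ) σ↭

  -- Of the 2t + 3 − x entries above x one precedes x, while at least 2t follow it.
  nonLRMax-descent-2-1 : ∀ ys {x z} zs → iter t s σ ≡ ys ++ x ∷ z ∷ zs → z < x → Any (x <_) ys → x ≡ 2 × z ≡ 1
  nonLRMax-descent-2-1 ys {x} {z} zs π≡ z<x x<ys = x≡2 , z≡1
    where
    bounds : ∀ {w} → w ∈ ys ++ x ∷ z ∷ zs → 0 < w × w ≤ N
    bounds w∈ = perm-∈⁻ π↭ (subst (_ ∈_) (sym π≡) w∈)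
    x≤N : x ≤ N
    x≤N = proj₂ (bounds (∈-insert ys))
    0<z : 0 < z
    0<z = proj₁ (bounds (∈-++⁺ʳ ys (there (here refl))))
    count : #above x ys + #above x (z ∷ zs) ≡ N ∸ x
    count = begin
      #above x ys + #above x (z ∷ zs)        ≡⟨ cong (#above x ys +_) (sym (≡.trans (#above-∷ x x (z ∷ zs)) (cong (_+ #above x (z ∷ zs)) (exceeds-no {x} ≤-refl)))) ⟩
      #above x ys + #above x (x ∷ z ∷ zs)    ≡⟨ sym (#above-++ x ys _) ⟩
      #above x (ys ++ x ∷ z ∷ zs)            ≡⟨ cong (#above x) (sym π≡) ⟩
      #above x (iter t s σ)                  ≡⟨ #above-↭ x π↭ ⟩
      #above x (range1 N)                    ≡⟨ cong (#above x ∘ range1) (sym (m+[n∸m]≡n x≤N)) ⟩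
      #above x (range1 (x + (N ∸ x)))        ≡⟨ #above-range1 x (N ∸ x) ⟩
      N ∸ x                                  ∎
      where open ≡.≡-Reasoning
    many-above : suc (t + t) ≤ N ∸ x
    many-above = ≤-trans (+-mono-≤ (Any-above x ys x<ys)
                                   (≤-trans (iter-s-descent-ndt t (perm-unique σ↭) ys zs π≡ z<x x<ys) (ndt≤#above x (z ∷ zs))))
                         (≤-reflexive count)
    x≤2 : x ≤ 2
    x≤2 with x ≤? 2
    ... | yes x≤2 = x≤2
    ... | no  x≰2 = ⊥-elim (<⇒≱ many-above (≤-trans (∸-monoʳ-≤ N (≰⇒> x≰2)) (≤-reflexive (cong (_∸ 3) (t+[3+t] t)))))
    x≡2 : x ≡ 2
    x≡2 = ≤-antisym x≤2 (≤-trans (s≤s 0<z) z<x)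
    z≡1 : z ≡ 1
    z≡1 = ≤-antisym (≤-pred (≤-trans z<x x≤2)) 0<z

  length-2-1 : ∀ ys zs → iter t s σ ≡ ys ++ 2 ∷ 1 ∷ zs → length ys + length zs ≡ suc (t + t)
  length-2-1 ys zs π≡ = suc-injective (suc-injective (begin
    suc (suc (length ys + length zs))  ≡⟨ sym (≡.trans (length-++ ys) (≡.trans (+-suc _ _) (cong suc (+-suc _ _)))) ⟩
    length (ys ++ 2 ∷ 1 ∷ zs)          ≡⟨ cong length (sym π≡) ⟩
    length (iter t s σ)                ≡⟨ ↭-length π↭ ⟩
    length (range1 N)                  ≡⟨ length-range1 N ⟩
    N                                  ≡⟨ t+[3+t] t ⟩
    3 + (t + t)                        ∎))
    where open ≡.≡-Reasoning

  -- ys and zs share the 2t + 1 entries above 2, and zs contains 2t entries that are not descent tops.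
  descent-2-1⇒zeta : ∀ ys zs → iter t s σ ≡ ys ++ 2 ∷ 1 ∷ zs → Any (2 <_) ys → t + t ≤ ndt 2 zs →
                     ∃[ ℓ ] 3 ≤ ℓ × ℓ ≤ 3 + t × iter t s σ ≡ zeta ℓ (3 + t)
  descent-2-1⇒zeta (ℓ ∷ []) zs π≡ (here 2<ℓ) t+t≤ = ℓ , 2<ℓ , ℓ≤m , ≡.trans π≡ (cong (λ zs → ℓ ∷ 2 ∷ 1 ∷ zs) zs≡)
    where
    π′↭ : ℓ ∷ 2 ∷ 1 ∷ zs ↭ range1 N
    π′↭ = subst (_↭ range1 N) π≡ π↭
    ℓ≤m : ℓ ≤ 3 + t
    ℓ≤m with iter-s-tail t σ↭
    ... | b ∷ β , β↭ , π≡β = subst (_≤ 3 + t) (sym (∷-injectiveˡ (≡.trans (sym π≡) π≡β))) (proj₂ (perm-∈⁻ β↭ (here refl)))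
    ... | [] , β↭ , _ with perm-∈⁺ β↭ {1} (s≤s z≤n) (s≤s z≤n)
    ...   | ()
    zs≡ : zs ≡ zetaTail ℓ (3 + t)
    zs≡ = zeta-completion t π′↭ (ndt-full⇒ascending 2 zs (Unique-++⁻ʳ (ℓ ∷ 2 ∷ 1 ∷ []) (perm-unique π′↭))
                                   (≤-trans (≤-reflexive (suc-injective (length-2-1 [ ℓ ] zs π≡))) t+t≤))
  descent-2-1⇒zeta (ℓ ∷ y ∷ ys) zs π≡ _ t+t≤ =
    ⊥-elim (<⇒≱ (≤-reflexive (length-2-1 (ℓ ∷ y ∷ ys) zs π≡))
                (s≤s (≤-trans (≤-trans t+t≤ (ndt≤length 2 zs)) (m≤n+m _ (length ys)))))

  nonLRMax-descent⇒zeta : ∀ ys {x z} zs → iter t s σ ≡ ys ++ x ∷ z ∷ zs → z < x → Any (x <_) ys →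
                          ∃[ ℓ ] 3 ≤ ℓ × ℓ ≤ 3 + t × iter t s σ ≡ zeta ℓ (3 + t)
  nonLRMax-descent⇒zeta ys zs π≡ z<x x<ys with nonLRMax-descent-2-1 ys zs π≡ z<x x<ys
  ... | refl , refl = descent-2-1⇒zeta ys zs π≡ x<ys
    (≤-trans (iter-s-descent-ndt t (perm-unique σ↭) ys zs π≡ z<x x<ys) (ndt-∷-≤ 2 1 zs))

DescentTopsLRMax : List ℕ → Set
DescentTopsLRMax π = ∀ ys {x z} zs → π ≡ ys ++ x ∷ z ∷ zs → z < x → All (_< x) ys

LRMax⇒DescentTopsLRMax : ∀ {π} → Unique π → ((x : ℕ) → DescentTop π x → LRMax π x) → DescentTopsLRMax π
LRMax⇒DescentTopsLRMax uπ lrmax ys {x} {z} zs π≡ z<x with lrmax x (ys , z , zs , π≡ , z<x)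
... | ys′ , zs′ , π≡′ , ys′<x =
  subst (All (_< x)) (sym (Unique-++-∷-cancel ys ys′ (subst Unique π≡ uπ) (≡.trans (sym π≡) π≡′))) ys′<x

DescentTopsLRMax⇒LRMax : ∀ {π} → DescentTopsLRMax π → (x : ℕ) → DescentTop π x → LRMax π x
DescentTopsLRMax⇒LRMax dt x (ys , z , zs , π≡ , z<x) = ys , z ∷ zs , π≡ , dt ys zs π≡ z<x

DescentTopsLRMax-++⁻ˡ : ∀ β {T} → DescentTopsLRMax (β ++ T) → DescentTopsLRMax β
DescentTopsLRMax-++⁻ˡ β {T} dt ys zs β≡ = dt ys (zs ++ T) (≡.trans (cong (_++ T) β≡) (++-assoc ys _ T))

-- π = B₁ ++ ⋯ ++ Bₖ, where each block Bᵢ = Mᵢ ∷ Dᵢ starts with its maximum, Dᵢ is ascending, and M₁ < ⋯ < Mₖ.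
data BlockForm : List ℕ → Set where
  []   : BlockForm []
  snoc : ∀ {π} M D → BlockForm π → All (_< M) π → All (_< M) D → Ascending D → BlockForm (π ++ M ∷ D)

BlockForm⇒DescentTopsLRMax : ∀ {π} → BlockForm π → DescentTopsLRMax π
BlockForm⇒DescentTopsLRMax []                           ys {x} {z} zs π≡ _ with ++-conicalʳ ys (x ∷ z ∷ zs) (sym π≡)
... | ()
BlockForm⇒DescentTopsLRMax (snoc {π} M D g π<M D<M ascD) ys zs π≡ z<x with adjacent-++ ys zs π (sym π≡)
... | inLeft zs₁ π≡′ _         = BlockForm⇒DescentTopsLRMax g ys zs₁ π≡′ z<x
... | between π≡′ MD≡          = ⊥-elim (<-asym z<x (subst (_ <_) (proj₁ (∷-injective MD≡))
                                                    (All.lookup π<M (subst (_ ∈_) (sym π≡′) (∈-insert ys)))))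
... | inRight [] ys≡ MD≡       with ∷-injective MD≡
...   | refl , _ = subst (All (_< M)) (sym (≡.trans ys≡ (++-identityʳ π))) π<M
BlockForm⇒DescentTopsLRMax (snoc {π} M D g π<M D<M ascD) ys zs π≡ z<x
    | inRight (_ ∷ ys₂) _ MD≡  with ∷-injective MD≡
...   | _ , D≡ = ⊥-elim (<-asym z<x (All.head (AllPairs.head (proj₁ (proj₂ (AllPairs-++⁻ ys₂ (subst Ascending D≡ ascD)))))))

DescentTopsLRMax-++ : ∀ {β T} → DescentTopsLRMax β → Ascending T → β ≪ T → DescentTopsLRMax (β ++ T)
DescentTopsLRMax-++ {β} {T} dt ascT β≪T ys zs π≡ z<x with adjacent-++ ys zs β (sym π≡)
... | inLeft zs₁ β≡ _     = dt ys zs₁ β≡ z<x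
... | between β≡ T≡       = ⊥-elim (<-asym z<x (All.lookup (All.lookup β≪T (subst (_ ∈_) (sym β≡) (∈-insert ys)))
                                                           (subst (_ ∈_) (sym T≡) (here refl))))
... | inRight ys₂ _ T≡    = ⊥-elim (<-asym z<x (All.head (AllPairs.head (proj₁ (proj₂ (AllPairs-++⁻ ys₂ (subst Ascending T≡ ascT)))))))

no-adjacent-descent⇒ascending : ∀ {R} → Unique R → (∀ ys {x z} zs → R ≡ ys ++ x ∷ z ∷ zs → ¬ z < x) → Ascending R
no-adjacent-descent⇒ascending {[]}        _                 _   = []
no-adjacent-descent⇒ascending {x ∷ []}    _                 _   = [] ∷ []
no-adjacent-descent⇒ascending {x ∷ y ∷ R} ((x≢y ∷ _) ∷ uR) asc =
  (x<y ∷ All.map (<-trans x<y) (AllPairs.head rest)) ∷ rest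
  where
  x<y : x < y
  x<y = ≤∧≢⇒< (≮⇒≥ (asc [] R refl)) x≢y
  rest : Ascending (y ∷ R)
  rest = no-adjacent-descent⇒ascending uR (λ ys zs R≡ → asc (x ∷ ys) zs (cong (x ∷_) R≡))

DescentTopsLRMax⇒BlockForm : ∀ {π} → Unique π → DescentTopsLRMax π → BlockForm π
DescentTopsLRMax⇒BlockForm = unique-max-induction (λ π → DescentTopsLRMax π → BlockForm π) (λ _ → []) step
  where
  step : ∀ {L M R} → All (_< M) L → All (_< M) R → Unique L → Unique R →
         (DescentTopsLRMax L → BlockForm L) → (DescentTopsLRMax R → BlockForm R) →
         DescentTopsLRMax (L ++ M ∷ R) → BlockForm (L ++ M ∷ R)
  step {L} {M} {R} L<M R<M _ uR ihL _ dt =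
    snoc M R (ihL (DescentTopsLRMax-++⁻ˡ L dt)) L<M R<M (no-adjacent-descent⇒ascending uR descent-in-R)
    where
    descent-in-R : ∀ ys {x z} zs → R ≡ ys ++ x ∷ z ∷ zs → ¬ z < x
    descent-in-R ys {x} zs R≡ z<x = <-asym (All.lookup R<M (subst (x ∈_) (sym R≡) (∈-insert ys)))
      (All.lookup (dt (L ++ M ∷ ys) zs (≡.trans (cong (λ R → L ++ M ∷ R) R≡) (sym (++-assoc L (M ∷ ys) _))) z<x)
                  (∈-++⁺ʳ L (here refl)))

-- s (M₁ M₂D₁ M₃D₂ ⋯ MₖDₖ₋₁ a Dₖ) = M₁D₁ M₂D₂ ⋯ MₖDₖ a: the preimage shifts every block maximum one block left.
snoc-preimage : ∀ {π} → BlockForm π → ∀ {a} → All (_< a) π → ∃[ τ ] BlockForm τ × s τ ≡ π ++ [ a ]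
snoc-preimage [] {a} _ = [ a ] , snoc a [] [] [] [] [] , s-split [] [] [] []
snoc-preimage (snoc {π} M D g π<M D<M ascD) {a} πMD<a with snoc-preimage g π<M
... | τ , gτ , sτ≡ = τ ++ a ∷ D , snoc a D gτ τ<a D<a ascD , sτaD≡
  where
  M<a = All.head (All.++⁻ʳ π πMD<a)
  D<a = All.tail (All.++⁻ʳ π πMD<a)
  τ<a : All (_< a) τ
  τ<a = All-resp-↭ (subst (_↭ τ) sτ≡ (s-↭ τ)) (All.++⁺ (All.++⁻ˡ π πMD<a) (M<a ∷ []))
  sτaD≡ : s (τ ++ a ∷ D) ≡ (π ++ M ∷ D) ++ [ a ]
  sτaD≡ = begin
    s (τ ++ a ∷ D)            ≡⟨ s-split τ D τ<a (All.map <⇒≤ D<a) ⟩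
    s τ ++ s D ++ [ a ]       ≡⟨ cong₂ (λ l r → l ++ r ++ [ a ]) sτ≡ (s-ascending ascD) ⟩
    (π ++ [ M ]) ++ D ++ [ a ] ≡⟨ ++-assoc π [ M ] _ ⟩
    π ++ M ∷ D ++ [ a ]       ≡⟨ sym (++-assoc π (M ∷ D) [ a ]) ⟩
    (π ++ M ∷ D) ++ [ a ]     ∎
    where open ≡.≡-Reasoning

iter-preimage : ∀ {π} → BlockForm π → ∀ T → Ascending T → π ≪ T → ∃[ σ ] iter (length T) s σ ≡ π ++ T
iter-preimage {π} g []      _            _     = π , sym (++-identityʳ π)
iter-preimage {π} g (a ∷ T) (a<T ∷ ascT) π≪aT with snoc-preimage g (All.map All.head π≪aT)
... | τ , gτ , sτ≡ = map₂ extend (iter-preimage gτ T ascT τ≪T)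
  where
  τ≪T : τ ≪ T
  τ≪T = All-resp-↭ (subst (_↭ τ) sτ≡ (s-↭ τ)) (All.++⁺ (All.map All.tail π≪aT) (a<T ∷ []))
  extend : ∀ {σ} → iter (length T) s σ ≡ τ ++ T → s (iter (length T) s σ) ≡ π ++ a ∷ T
  extend {σ} iter≡ = begin
    s (iter (length T) s σ)   ≡⟨ cong s iter≡ ⟩
    s (τ ++ T)                ≡⟨ s-++-ascending τ ascT τ≪T ⟩
    s τ ++ T                  ≡⟨ cong (_++ T) sτ≡ ⟩
    (π ++ [ a ]) ++ T         ≡⟨ ++-assoc π [ a ] T ⟩
    π ++ a ∷ T                ∎
    where open ≡.≡-Reasoning

tail-DescentTopsLRMax⇒image : ∀ j a {π} → π ↭ range1 (j + a) → j ≤ tl (j + a) π → DescentTopsLRMax π →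
                              ∃[ σ ] iter j s σ ≡ π
tail-DescentTopsLRMax⇒image j a {π} π↭ j≤tl dt with tl-interval⁻ j a π j≤tl
... | β , refl = map₂ (subst (λ k → iter k s _ ≡ β ++ interval a j) (length-interval a j))
                      (iter-preimage gβ (interval a j) (interval-ascending a j) β≪T)
  where
  uπ = perm-unique π↭
  gβ : BlockForm β
  gβ = DescentTopsLRMax⇒BlockForm (Unique-++⁻ˡ β uπ) (DescentTopsLRMax-++⁻ˡ β dt)
  β≤a : All (_≤ a) β
  β≤a = All.tabulate (λ {w} w∈ → ≮⇒≥ (λ a<w → Unique-++-disjoint β uπ w∈
          (∈-interval⁺ a j a<w (proj₂ (perm-∈⁻ π↭ (∈-++⁺ˡ w∈))))))
  β≪T : β ≪ interval a j
  β≪T = All.map (λ w≤a → All.map (≤-<-trans w≤a) (interval-above a j)) β≤a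

-- With C = 3 ⋯ m without ℓ and B = (m+1) ⋯ (2m−3) we have ζ_{ℓ,m} = zetaShape ℓ [] [] C B. Each application of s
-- moves the last entry of B₁ in front of B₂ and the last entry of C₁ behind 1, so zetaShape ℓ B C [] [] is a
-- preimage of ζ_{ℓ,m} under s^(m−3).
zetaShape : ℕ → List ℕ → List ℕ → List ℕ → List ℕ → List ℕ
zetaShape ℓ B₁ C₁ C₂ B₂ = ℓ ∷ B₁ ++ 2 ∷ C₁ ++ 1 ∷ C₂ ++ B₂

s-2∷C∷1 : ∀ C₁ {c C₂} → Ascending (C₁ ++ c ∷ C₂) → All (2 <_) (C₁ ++ c ∷ C₂) →
          s (2 ∷ C₁ ++ c ∷ 1 ∷ C₂) ≡ 2 ∷ C₁ ++ 1 ∷ c ∷ C₂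
s-2∷C∷1 C₁ {c} {C₂} ascC 2<C = begin
  s (2 ∷ C₁ ++ c ∷ 1 ∷ C₂)              ≡⟨ cong s (sym (++-assoc (2 ∷ C₁) (c ∷ [ 1 ]) C₂)) ⟩
  s ((2 ∷ C₁ ++ c ∷ [ 1 ]) ++ C₂)       ≡⟨ s-++-ascending (2 ∷ C₁ ++ c ∷ [ 1 ]) ascC₂ below-C₂ ⟩
  s (2 ∷ C₁ ++ c ∷ [ 1 ]) ++ C₂         ≡⟨ cong (_++ C₂) (s-split (2 ∷ C₁) [ 1 ] (2<c ∷ C₁<c) (<⇒≤ (<-trans (s≤s (s≤s z≤n)) 2<c) ∷ [])) ⟩
  (s (2 ∷ C₁) ++ 1 ∷ [ c ]) ++ C₂       ≡⟨ cong (λ l → (l ++ 1 ∷ [ c ]) ++ C₂) (s-ascending (All.++⁻ˡ C₁ 2<C ∷ ascC₁)) ⟩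
  ((2 ∷ C₁) ++ 1 ∷ [ c ]) ++ C₂         ≡⟨ ++-assoc (2 ∷ C₁) (1 ∷ [ c ]) C₂ ⟩
  2 ∷ C₁ ++ 1 ∷ c ∷ C₂                  ∎
  where
  open ≡.≡-Reasoning
  ascC₁ = proj₁ (AllPairs-++⁻ C₁ ascC)
  asccC₂ = proj₁ (proj₂ (AllPairs-++⁻ C₁ ascC))
  C₁≪cC₂ = proj₂ (proj₂ (AllPairs-++⁻ C₁ ascC))
  ascC₂ = AllPairs.tail asccC₂
  2<c = All.head (All.++⁻ʳ C₁ 2<C)
  2<C₂ = All.tail (All.++⁻ʳ C₁ 2<C)
  C₁<c = All.map All.head C₁≪cC₂
  below-C₂ : (2 ∷ C₁ ++ c ∷ [ 1 ]) ≪ C₂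
  below-C₂ = 2<C₂ ∷ All.++⁺ (All.map All.tail C₁≪cC₂)
                            (AllPairs.head asccC₂ ∷ All.map (<-trans (s≤s (s≤s z≤n))) 2<C₂ ∷ [])

zetaShape-snoc : ∀ ℓ B₁ b B₂ C₁ c C₂ →
                 zetaShape ℓ (B₁ ++ [ b ]) (C₁ ++ [ c ]) C₂ B₂ ≡ (ℓ ∷ B₁ ++ b ∷ 2 ∷ C₁ ++ c ∷ 1 ∷ C₂) ++ B₂
zetaShape-snoc ℓ B₁ b B₂ C₁ c C₂ = cong (ℓ ∷_) (begin
  (B₁ ++ [ b ]) ++ 2 ∷ (C₁ ++ [ c ]) ++ 1 ∷ C₂ ++ B₂  ≡⟨ ++-assoc B₁ [ b ] _ ⟩
  B₁ ++ b ∷ 2 ∷ (C₁ ++ [ c ]) ++ 1 ∷ C₂ ++ B₂         ≡⟨ cong (λ w → B₁ ++ b ∷ 2 ∷ w) (++-assoc C₁ [ c ] _) ⟩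
  B₁ ++ b ∷ 2 ∷ C₁ ++ c ∷ 1 ∷ C₂ ++ B₂               ≡⟨ cong (λ w → B₁ ++ b ∷ 2 ∷ w) (sym (++-assoc C₁ (c ∷ 1 ∷ C₂) B₂)) ⟩
  B₁ ++ b ∷ (2 ∷ C₁ ++ c ∷ 1 ∷ C₂) ++ B₂             ≡⟨ sym (++-assoc B₁ _ B₂) ⟩
  (B₁ ++ b ∷ 2 ∷ C₁ ++ c ∷ 1 ∷ C₂) ++ B₂             ∎)
  where open ≡.≡-Reasoning

zetaShape-shift : ∀ ℓ B₁ b B₂ C₁ c C₂ →
                  ((ℓ ∷ B₁) ++ (2 ∷ C₁ ++ 1 ∷ c ∷ C₂) ++ [ b ]) ++ B₂ ≡ zetaShape ℓ B₁ C₁ (c ∷ C₂) (b ∷ B₂)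
zetaShape-shift ℓ B₁ b B₂ C₁ c C₂ = cong (ℓ ∷_) (begin
  (B₁ ++ (2 ∷ C₁ ++ 1 ∷ c ∷ C₂) ++ [ b ]) ++ B₂   ≡⟨ ++-assoc B₁ _ B₂ ⟩
  B₁ ++ ((2 ∷ C₁ ++ 1 ∷ c ∷ C₂) ++ [ b ]) ++ B₂   ≡⟨ cong (B₁ ++_) (++-assoc (2 ∷ C₁ ++ 1 ∷ c ∷ C₂) [ b ] B₂) ⟩
  B₁ ++ (2 ∷ C₁ ++ 1 ∷ c ∷ C₂) ++ b ∷ B₂          ≡⟨ cong (λ w → B₁ ++ 2 ∷ w) (++-assoc C₁ (1 ∷ c ∷ C₂) (b ∷ B₂)) ⟩
  B₁ ++ 2 ∷ C₁ ++ 1 ∷ (c ∷ C₂) ++ b ∷ B₂          ∎)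
  where open ≡.≡-Reasoning

module _ {m ℓ} (ℓ≤m : ℓ ≤ m) where

  s-zetaShape : ∀ B₁ {b B₂} C₁ {c C₂} → Ascending (B₁ ++ b ∷ B₂) → Ascending (C₁ ++ c ∷ C₂) →
                All (m <_) (B₁ ++ b ∷ B₂) → All (λ c → 2 < c × c ≤ m) (C₁ ++ c ∷ C₂) →
                s (zetaShape ℓ (B₁ ++ [ b ]) (C₁ ++ [ c ]) C₂ B₂) ≡ zetaShape ℓ B₁ C₁ (c ∷ C₂) (b ∷ B₂)
  s-zetaShape B₁ {b} {B₂} C₁ {c} {C₂} ascB ascC m<B C∈ = begin
    s (zetaShape ℓ (B₁ ++ [ b ]) (C₁ ++ [ c ]) C₂ B₂)    ≡⟨ cong s (zetaShape-snoc ℓ B₁ b B₂ C₁ c C₂) ⟩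
    s (X ++ B₂)                                          ≡⟨ s-++-ascending X ascB₂ X≪B₂ ⟩
    s X ++ B₂                                            ≡⟨ cong (_++ B₂) (s-split (ℓ ∷ B₁) Y (ℓ<b ∷ B₁<b) Y≤b) ⟩
    (s (ℓ ∷ B₁) ++ s Y ++ [ b ]) ++ B₂                   ≡⟨ cong₂ (λ l y → (l ++ y ++ [ b ]) ++ B₂) (s-ascending ascℓB₁)
                                                                 (s-2∷C∷1 C₁ ascC (All.map proj₁ C∈)) ⟩
    ((ℓ ∷ B₁) ++ (2 ∷ C₁ ++ 1 ∷ c ∷ C₂) ++ [ b ]) ++ B₂  ≡⟨ zetaShape-shift ℓ B₁ b B₂ C₁ c C₂ ⟩
    zetaShape ℓ B₁ C₁ (c ∷ C₂) (b ∷ B₂)                  ∎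
    where
    open ≡.≡-Reasoning
    Y = 2 ∷ C₁ ++ c ∷ 1 ∷ C₂
    X = ℓ ∷ B₁ ++ b ∷ Y
    ascB₁ = proj₁ (AllPairs-++⁻ B₁ ascB)
    ascbB₂ = proj₁ (proj₂ (AllPairs-++⁻ B₁ ascB))
    B₁≪bB₂ = proj₂ (proj₂ (AllPairs-++⁻ B₁ ascB))
    ascB₂ = AllPairs.tail ascbB₂
    m<b = All.head (All.++⁻ʳ B₁ m<B)
    ℓ<b = ≤-<-trans ℓ≤m m<b
    B₁<b = All.map All.head B₁≪bB₂
    ascℓB₁ : Ascending (ℓ ∷ B₁)
    ascℓB₁ = All.map (≤-<-trans ℓ≤m) (All.++⁻ˡ B₁ m<B) ∷ ascB₁
    Y≤m : All (_≤ m) Y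
    Y≤m = ≤-trans (n≤1+n 2) (≤-trans (proj₁ c∈) (proj₂ c∈)) ∷ All.++⁺ (All.map proj₂ (All.++⁻ˡ C₁ C∈))
            (proj₂ c∈ ∷ ≤-trans (s≤s z≤n) (≤-trans (proj₁ c∈) (proj₂ c∈)) ∷ All.map proj₂ (All.tail (All.++⁻ʳ C₁ C∈)))
      where c∈ = All.head (All.++⁻ʳ C₁ C∈)
    Y≤b : All (_≤ b) Y
    Y≤b = All.map (λ w≤m → <⇒≤ (≤-<-trans w≤m m<b)) Y≤m
    X≪B₂ : X ≪ B₂
    X≪B₂ = All.map (≤-<-trans ℓ≤m) m<B₂
         ∷ All.++⁺ (All.map All.tail B₁≪bB₂) (AllPairs.head ascbB₂ ∷ All.map (λ w≤m → All.map (≤-<-trans w≤m) m<B₂) Y≤m)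
      where m<B₂ = All.tail (All.++⁻ʳ B₁ m<B)

  iter-zetaShape : ∀ j {B₁ B₂ C₁ C₂} → length B₁ ≡ j → length C₁ ≡ j →
                   Ascending (B₁ ++ B₂) → Ascending (C₁ ++ C₂) → All (m <_) (B₁ ++ B₂) → All (λ c → 2 < c × c ≤ m) (C₁ ++ C₂) →
                   iter j s (zetaShape ℓ B₁ C₁ C₂ B₂) ≡ zetaShape ℓ [] [] (C₁ ++ C₂) (B₁ ++ B₂)
  iter-zetaShape zero    {[]} {_} {[]} _ _ _ _ _ _ = refl
  iter-zetaShape (suc j) {B₁} {B₂} {C₁} {C₂} |B₁| |C₁| ascB ascC m<B C∈
    with snoc-view B₁ |B₁| | snoc-view C₁ |C₁|
  ... | B₁′ , b , refl , |B₁′| | C₁′ , c , refl , |C₁′| = begin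
    iter (suc j) s (zetaShape ℓ (B₁′ ++ [ b ]) (C₁′ ++ [ c ]) C₂ B₂)    ≡⟨ iter-suc j s _ ⟩
    iter j s (s (zetaShape ℓ (B₁′ ++ [ b ]) (C₁′ ++ [ c ]) C₂ B₂))      ≡⟨ cong (iter j s) (s-zetaShape B₁′ C₁′ ascB′ ascC′ m<B′ C∈′) ⟩
    iter j s (zetaShape ℓ B₁′ C₁′ (c ∷ C₂) (b ∷ B₂))                    ≡⟨ iter-zetaShape j |B₁′| |C₁′| ascB′ ascC′ m<B′ C∈′ ⟩
    zetaShape ℓ [] [] (C₁′ ++ c ∷ C₂) (B₁′ ++ b ∷ B₂)                   ≡⟨ cong₂ (zetaShape ℓ [] []) (sym (++-assoc C₁′ [ c ] C₂)) (sym (++-assoc B₁′ [ b ] B₂)) ⟩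
    zetaShape ℓ [] [] ((C₁′ ++ [ c ]) ++ C₂) ((B₁′ ++ [ b ]) ++ B₂)     ∎
    where
    open ≡.≡-Reasoning
    B≡ = ++-assoc B₁′ [ b ] B₂
    C≡ = ++-assoc C₁′ [ c ] C₂
    ascB′ = subst Ascending B≡ ascB
    ascC′ = subst Ascending C≡ ascC
    m<B′ = subst (All (m <_)) B≡ m<B
    C∈′ = subst (All (λ c → 2 < c × c ≤ m)) C≡ C∈

zeta-preimage : ∀ t {ℓ} → 3 ≤ ℓ → ℓ ≤ 3 + t → ∃[ σ ] iter t s σ ≡ zeta ℓ (3 + t)
zeta-preimage t {ℓ} 3≤ℓ ℓ≤m = zetaShape ℓ Bs Cs [] [] , (begin
  iter t s (zetaShape ℓ Bs Cs [] [])         ≡⟨ iter-zetaShape ℓ≤m t (length-interval m t) |Cs| (sub Ascending Bs≡ ascBs) (sub Ascending Cs≡ ascCs)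
                                                 (sub (All (m <_)) Bs≡ (interval-above m t)) (sub (All (λ c → 2 < c × c ≤ m)) Cs≡ Cs∈) ⟩
  zetaShape ℓ [] [] (Cs ++ []) (Bs ++ [])    ≡⟨ cong₂ (zetaShape ℓ [] []) Cs≡ Bs≡ ⟩
  ℓ ∷ 2 ∷ 1 ∷ Cs ++ Bs                       ≡⟨ cong (λ zs → ℓ ∷ 2 ∷ 1 ∷ zs) (sym tail≡) ⟩
  zeta ℓ m                                 ∎)
  where
  open ≡.≡-Reasoning
  m = 3 + t
  ≢ℓ? = λ x → ¬? (x ≟ ℓ)
  Bs = interval m t
  Cs = filter ≢ℓ? (interval 2 (suc t))
  Bs≡ = ++-identityʳ Bs
  Cs≡ = ++-identityʳ Cs
  sub : (P : List ℕ → Set) {xs : List ℕ} → xs ++ [] ≡ xs → P xs → P (xs ++ [])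
  sub P e = subst P (sym e)
  m≡ : suc t + 2 ≡ m
  m≡ = cong suc (+-comm t 2)
  ascBs = interval-ascending m t
  ascCs = AllPairs.filter⁺ ≢ℓ? (interval-ascending 2 (suc t))
  Cs∈ : All (λ c → 2 < c × c ≤ m) Cs
  Cs∈ = All.tabulate (λ c∈ → let (2<c , c≤) = ∈-interval⁻ 2 (suc t) (proj₁ (∈-filter⁻ ≢ℓ? c∈)) in 2<c , ≤-trans c≤ (≤-reflexive m≡))
  |Cs| : length Cs ≡ t
  |Cs| = suc-injective (≡.trans (length-filter-≢ (interval 2 (suc t)) (Ascending⇒Unique (interval-ascending 2 (suc t)))
                                                  (∈-interval⁺ 2 (suc t) 3≤ℓ (subst (ℓ ≤_) (sym m≡) ℓ≤m)))
                                (length-interval 2 (suc t)))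
  tail≡ : zetaTail ℓ m ≡ Cs ++ Bs
  tail≡ = begin
    zetaTail ℓ m                                             ≡⟨ zetaTail≡ t ℓ ⟩
    filter ≢ℓ? (interval 2 (suc t + t))                         ≡⟨ cong (filter ≢ℓ?) (interval-++ 2 (suc t) t) ⟩
    filter ≢ℓ? (interval 2 (suc t) ++ interval (suc t + 2) t)      ≡⟨ filter-++ ≢ℓ? (interval 2 (suc t)) _ ⟩
    Cs ++ filter ≢ℓ? (interval (suc t + 2) t)                    ≡⟨ cong (Cs ++_) (filter-all ≢ℓ? (All.map (λ m<x x≡ℓ → <-irrefl (sym x≡ℓ) (≤-<-trans ℓ≤m m<x)) m<B′)) ⟩
    Cs ++ interval (suc t + 2) t                                 ≡⟨ cong (λ a → Cs ++ interval a t) m≡ ⟩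
    Cs ++ Bs                                                   ∎
    where
    m<B′ : All (m <_) (interval (suc t + 2) t)
    m<B′ = subst (λ a → All (a <_) (interval (suc t + 2) t)) m≡ (interval-above (suc t + 2) t)

-- Bell numbers

binomialSum : ℕ → (ℕ → ℕ) → ℕ
binomialSum n g = sum (applyUpTo (λ k → (n C k) * g k) (suc n))

+-exchange : ∀ a b c → a + (b + c) ≡ b + (a + c)
+-exchange a b c = ≡.trans (sym (+-assoc a b c)) (≡.trans (cong (_+ c) (+-comm a b)) (+-assoc b a c))

sum-applyUpTo-cong : ∀ {a b : ℕ → ℕ} → (∀ k → a k ≡ b k) → ∀ j → sum (applyUpTo a j) ≡ sum (applyUpTo b j)
sum-applyUpTo-cong {a} {b} a≗b j =
  cong sum (≡.trans (sym (map-upTo a j)) (≡.trans (map-cong a≗b (upTo j)) (map-upTo b j)))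

sum-applyUpTo-+ : ∀ (a b : ℕ → ℕ) j → sum (applyUpTo (λ k → a k + b k) j) ≡ sum (applyUpTo a j) + sum (applyUpTo b j)
sum-applyUpTo-+ a b zero    = refl
sum-applyUpTo-+ a b (suc j) = begin
  a 0 + b 0 + sum (applyUpTo (λ k → a (suc k) + b (suc k)) j)   ≡⟨ cong (a 0 + b 0 +_) (sum-applyUpTo-+ (a ∘ suc) (b ∘ suc) j) ⟩
  a 0 + b 0 + (A + B)                                            ≡⟨ +-assoc (a 0) (b 0) _ ⟩
  a 0 + (b 0 + (A + B))                                          ≡⟨ cong (a 0 +_) (+-exchange (b 0) A B) ⟩
  a 0 + (A + (b 0 + B))                                          ≡⟨ sym (+-assoc (a 0) A _) ⟩
  a 0 + A + (b 0 + B)                                            ∎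
  where
  open ≡.≡-Reasoning
  A = sum (applyUpTo (a ∘ suc) j)
  B = sum (applyUpTo (b ∘ suc) j)

sum-applyUpTo-last : ∀ (h : ℕ → ℕ) j → sum (applyUpTo h (suc j)) ≡ sum (applyUpTo h j) + h j
sum-applyUpTo-last h j = begin
  sum (applyUpTo h (suc j))            ≡⟨ cong sum (sym (applyUpTo-∷ʳ h j)) ⟩
  sum (applyUpTo h j ++ [ h j ])       ≡⟨ sum-++ (applyUpTo h j) [ h j ] ⟩
  sum (applyUpTo h j) + (h j + 0)      ≡⟨ cong (sum (applyUpTo h j) +_) (+-identityʳ (h j)) ⟩
  sum (applyUpTo h j) + h j            ∎
  where open ≡.≡-Reasoning

binomialSum-suc : ∀ n g → binomialSum (suc n) g ≡ binomialSum n (g ∘ suc) + binomialSum n g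
binomialSum-suc n g = begin
  (suc n C 0) * g 0 + sum (applyUpTo (λ k → (suc n C suc k) * g (suc k)) (suc n))
    ≡⟨ cong₂ _+_ (*-identityˡ (g 0)) (sum-applyUpTo-cong pascal (suc n)) ⟩
  g 0 + sum (applyUpTo (λ k → (n C k) * g (suc k) + (n C suc k) * g (suc k)) (suc n))
    ≡⟨ cong (g 0 +_) (sum-applyUpTo-+ (λ k → (n C k) * g (suc k)) (λ k → (n C suc k) * g (suc k)) (suc n)) ⟩
  g 0 + (binomialSum n (g ∘ suc) + S)
    ≡⟨ +-exchange (g 0) (binomialSum n (g ∘ suc)) S ⟩
  binomialSum n (g ∘ suc) + (g 0 + S)
    ≡⟨ cong (binomialSum n (g ∘ suc) +_) shifted ⟩
  binomialSum n (g ∘ suc) + binomialSum n g ∎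
  where
  open ≡.≡-Reasoning
  S = sum (applyUpTo (λ k → (n C suc k) * g (suc k)) (suc n))
  pascal : ∀ k → (suc n C suc k) * g (suc k) ≡ (n C k) * g (suc k) + (n C suc k) * g (suc k)
  pascal k = ≡.trans (cong (_* g (suc k)) (sym (nCk+nC[k+1]≡[n+1]C[k+1] n k))) (*-distribʳ-+ (g (suc k)) (n C k) _)
  shifted : g 0 + S ≡ binomialSum n g
  shifted = begin
    g 0 + S                                                   ≡⟨ cong (_+ S) (sym (*-identityˡ (g 0))) ⟩
    sum (applyUpTo (λ k → (n C k) * g k) (suc (suc n)))       ≡⟨ sum-applyUpTo-last (λ k → (n C k) * g k) (suc n) ⟩
    binomialSum n g + (n C suc n) * g (suc n)                 ≡⟨ cong (λ c → binomialSum n g + c * g (suc n)) (k>n⇒nCk≡0 (n<1+n n)) ⟩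
    binomialSum n g + 0                                       ≡⟨ +-identityʳ _ ⟩
    binomialSum n g                                           ∎

foldl-last : ∀ (L : List ℕ) z x → foldl (λ _ b → b) z (L ++ [ x ]) ≡ x
foldl-last []      z x = refl
foldl-last (y ∷ L) z x = foldl-last L y x

bellList≡ : ∀ k → bellList k ≡ map bell (upTo k)
bellList≡ zero    = refl
bellList≡ (suc k) = begin
  bellList k ++ [ _ ]                ≡⟨ cong (bellList k ++_) (cong [_] (sym (foldl-last (bellList k) 0 _))) ⟩
  bellList k ++ [ bell k ]           ≡⟨ cong (_++ [ bell k ]) (bellList≡ k) ⟩
  map bell (upTo k) ++ [ bell k ]    ≡⟨ sym (map-++ bell (upTo k) [ k ]) ⟩
  map bell (upTo k ++ [ k ])         ≡⟨ cong (map bell) (upTo-∷ʳ k) ⟩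
  map bell (upTo (suc k))            ∎
  where open ≡.≡-Reasoning

zipWith-map : ∀ (h : ℕ → ℕ → ℕ) (g : ℕ → ℕ) xs → zipWith h xs (map g xs) ≡ map (λ x → h x (g x)) xs
zipWith-map h g []       = refl
zipWith-map h g (x ∷ xs) = cong (h x (g x) ∷_) (zipWith-map h g xs)

bell-suc : ∀ n → bell (suc n) ≡ binomialSum n bell
bell-suc n = begin
  bell (suc n)                                                          ≡⟨ foldl-last (bellList (suc n)) 0 _ ⟩
  sum (zipWith (λ k b → (n C k) * b) (upTo (suc n)) (bellList (suc n)))  ≡⟨ cong (λ bs → sum (zipWith (λ k b → (n C k) * b) (upTo (suc n)) bs)) (bellList≡ (suc n)) ⟩
  sum (zipWith (λ k b → (n C k) * b) (upTo (suc n)) (map bell (upTo (suc n)))) ≡⟨ cong sum (zipWith-map (λ k b → (n C k) * b) bell (upTo (suc n))) ⟩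
  sum (map (λ k → (n C k) * bell k) (upTo (suc n)))                     ≡⟨ cong sum (map-upTo (λ k → (n C k) * bell k) (suc n)) ⟩
  binomialSum n bell                                                    ∎
  where open ≡.≡-Reasoning

splits : List ℕ → List (List ℕ × List ℕ)
splits []       = [ [] , [] ]
splits (x ∷ xs) = map (map₁ (x ∷_)) (splits xs) ++ map (map₂ (x ∷_)) (splits xs)

splits-sound : ∀ xs {K D} → (K , D) ∈ splits xs → Interleaving K D xs
splits-sound []       (here refl) = []
splits-sound (x ∷ xs) p∈ with ∈-++⁻ (map (map₁ (x ∷_)) (splits xs)) p∈
... | inj₁ p∈ˡ with ∈-map⁻ (map₁ (x ∷_)) p∈ˡ
...   | _ , q∈ , refl = consˡ (splits-sound xs q∈)
splits-sound (x ∷ xs) p∈ | inj₂ p∈ʳ with ∈-map⁻ (map₂ (x ∷_)) p∈ʳ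
...   | _ , q∈ , refl = consʳ (splits-sound xs q∈)

splits-complete : ∀ {K D xs} → Interleaving K D xs → (K , D) ∈ splits xs
splits-complete []          = here refl
splits-complete (consˡ il) = ∈-++⁺ˡ (∈-map⁺ (map₁ (_ ∷_)) (splits-complete il))
splits-complete {xs = x ∷ xs} (consʳ il) = ∈-++⁺ʳ (map (map₁ (x ∷_)) (splits xs)) (∈-map⁺ (map₂ (x ∷_)) (splits-complete il))

module _ {K D xs : List ℕ} (il : Interleaving K D xs) where

  ∈-interleavingˡ : ∀ {z} → z ∈ K → z ∈ xs
  ∈-interleavingˡ z∈ = ∈-resp-↭ (↭-sym (toPermutation il)) (∈-++⁺ˡ z∈)

  ∈-interleavingʳ : ∀ {z} → z ∈ D → z ∈ xs
  ∈-interleavingʳ z∈ = ∈-resp-↭ (↭-sym (toPermutation il)) (∈-++⁺ʳ K z∈)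

splits-unique : ∀ {xs} → Unique xs → Unique (splits xs)
splits-unique {[]}     _          = [] ∷ []
splits-unique {x ∷ xs} (x∉ ∷ uxs) = Unique.++⁺ (Unique.map⁺ injˡ (splits-unique uxs)) (Unique.map⁺ injʳ (splits-unique uxs)) disjoint
  where
  injˡ : ∀ {p q : List ℕ × List ℕ} → map₁ (x ∷_) p ≡ map₁ (x ∷_) q → p ≡ q
  injˡ {_ , _} {_ , _} refl = refl
  injʳ : ∀ {p q : List ℕ × List ℕ} → map₂ (x ∷_) p ≡ map₂ (x ∷_) q → p ≡ q
  injʳ {_ , _} {_ , _} refl = refl
  disjoint : ∀ {v} → ¬ (v ∈ map (map₁ (x ∷_)) (splits xs) × v ∈ map (map₂ (x ∷_)) (splits xs))
  disjoint (v∈ˡ , v∈ʳ) with ∈-map⁻ (map₁ (x ∷_)) v∈ˡ | ∈-map⁻ (map₂ (x ∷_)) v∈ʳ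
  ... | (K , D) , p∈ , refl | _ , _ , refl = All.lookup x∉ (∈-interleavingʳ (splits-sound xs p∈) (here refl)) refl

splits-count : ∀ xs (g : ℕ → ℕ) → sum (map (g ∘ length ∘ proj₁) (splits xs)) ≡ binomialSum (length xs) g
splits-count []       g = cong (_+ 0) (sym (*-identityˡ (g 0)))
splits-count (x ∷ xs) g = begin
  sum (map h (map (map₁ (x ∷_)) S ++ map (map₂ (x ∷_)) S))                 ≡⟨ cong sum (map-++ h (map (map₁ (x ∷_)) S) _) ⟩
  sum (map h (map (map₁ (x ∷_)) S) ++ map h (map (map₂ (x ∷_)) S))         ≡⟨ sum-++ (map h (map (map₁ (x ∷_)) S)) _ ⟩
  sum (map h (map (map₁ (x ∷_)) S)) + sum (map h (map (map₂ (x ∷_)) S))   ≡⟨ cong₂ _+_ (cong sum (sym (map-∘ S))) (cong sum (sym (map-∘ S))) ⟩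
  sum (map (g ∘ suc ∘ length ∘ proj₁) S) + sum (map h S)                  ≡⟨ cong₂ _+_ (splits-count xs (g ∘ suc)) (splits-count xs g) ⟩
  binomialSum (length xs) (g ∘ suc) + binomialSum (length xs) g           ≡⟨ sym (binomialSum-suc (length xs) g) ⟩
  binomialSum (suc (length xs)) g                                         ∎
  where
  open ≡.≡-Reasoning
  S = splits xs
  h = g ∘ length ∘ proj₁

Interleaving-AllPairsˡ : ∀ {R : ℕ → ℕ → Set} {K D xs} → Interleaving K D xs → AllPairs R xs → AllPairs R K
Interleaving-AllPairsˡ []         []      = []
Interleaving-AllPairsˡ (consˡ il) (a ∷ p) = All.tabulate (λ z∈ → All.lookup a (∈-interleavingˡ il z∈)) ∷ Interleaving-AllPairsˡ il p
Interleaving-AllPairsˡ (consʳ il) (_ ∷ p) = Interleaving-AllPairsˡ il p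

Interleaving-AllPairsʳ : ∀ {R : ℕ → ℕ → Set} {K D xs} → Interleaving K D xs → AllPairs R xs → AllPairs R D
Interleaving-AllPairsʳ []         []      = []
Interleaving-AllPairsʳ (consʳ il) (a ∷ p) = All.tabulate (λ z∈ → All.lookup a (∈-interleavingʳ il z∈)) ∷ Interleaving-AllPairsʳ il p
Interleaving-AllPairsʳ (consˡ il) (_ ∷ p) = Interleaving-AllPairsʳ il p

Interleaving-determinedˡ : ∀ {K₁ K₂ D xs} → Unique xs → Interleaving K₁ D xs → Interleaving K₂ D xs → K₁ ≡ K₂
Interleaving-determinedˡ _         []          []          = refl
Interleaving-determinedˡ (_ ∷ u)   (consˡ il₁) (consˡ il₂) = cong (_ ∷_) (Interleaving-determinedˡ u il₁ il₂)
Interleaving-determinedˡ (_ ∷ u)   (consʳ il₁) (consʳ il₂) = Interleaving-determinedˡ u il₁ il₂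
Interleaving-determinedˡ (x∉ ∷ _)  (consˡ il₁) (consʳ il₂) = ⊥-elim (All.lookup x∉ (∈-interleavingʳ il₁ (here refl)) refl)
Interleaving-determinedˡ (x∉ ∷ _)  (consʳ il₁) (consˡ il₂) = ⊥-elim (All.lookup x∉ (∈-interleavingʳ il₂ (here refl)) refl)

filter-interleaving : ∀ {P : ℕ → Set} (P? : ∀ x → Dec (P x)) xs → Interleaving (filter (λ x → ¬? (P? x)) xs) (filter P? xs) xs
filter-interleaving P? []       = []
filter-interleaving P? (x ∷ xs) with P? x
... | yes _ = consʳ (filter-interleaving P? xs)
... | no  _ = consˡ (filter-interleaving P? xs)
range1↓ : ℕ → List ℕ
range1↓ = applyDownFrom suc

range1↓-descending : ∀ m → Descending (range1↓ m)
range1↓-descending m = AllPairs.applyDownFrom⁺₁ suc m (λ j<i _ → s≤s j<i)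

range1↓-↭ : ∀ m → range1↓ m ↭ range1 m
range1↓-↭ m = perm-from-∈ m (Descending⇒Unique (range1↓-descending m))
  (λ x∈ → let (i , i<m , x≡) = ∈-applyDownFrom⁻ suc x∈ in subst (0 <_) (sym x≡) (s≤s z≤n) , subst (_≤ m) (sym x≡) i<m)
  (λ { {suc x} _ x<m → ∈-applyDownFrom⁺ suc x<m })

-- blockForms f Sd lists the block forms of the descending list Sd (given fuel f > length Sd). The last block
-- is the maximum M followed by any subset D of the rest, and the remaining entries K form a block form of their
-- own; this is the recursion B_{n+1} = Σₖ C(n,k) Bₖ.
blockForms : ℕ → List ℕ → List (List ℕ)
withLastBlock : ℕ → ℕ → List ℕ × List ℕ → List (List ℕ)

blockForms zero    _        = []
blockForms (suc f) []       = [ [] ]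
blockForms (suc f) (M ∷ Sd) = concatMap (withLastBlock f M) (splits Sd)

withLastBlock f M (K , D) = map (_++ M ∷ reverse D) (blockForms f K)

last-block-sound : ∀ {M Sd K D π′} → All (_< M) Sd → Descending Sd → Interleaving K D Sd → π′ ↭ K → BlockForm π′ →
                   π′ ++ M ∷ reverse D ↭ M ∷ Sd × BlockForm (π′ ++ M ∷ reverse D)
last-block-sound {M} {Sd} {K} {D} {π′} Sd<M dSd il π′↭ gπ′ = perm , snoc M (reverse D) gπ′ π′<M rD<M (Descending-reverse (Interleaving-AllPairsʳ il dSd))
  where
  perm : π′ ++ M ∷ reverse D ↭ M ∷ Sd
  perm = ↭-trans (shift M π′ (reverse D)) (prep M (↭-trans (++⁺ π′↭ (↭-reverse D)) (↭-sym (toPermutation il))))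
  π′<M : All (_< M) π′
  π′<M = All.tabulate (λ z∈ → All.lookup Sd<M (∈-interleavingˡ il (∈-resp-↭ π′↭ z∈)))
  rD<M : All (_< M) (reverse D)
  rD<M = All.tabulate (λ z∈ → All.lookup Sd<M (∈-interleavingʳ il (∈-resp-↭ (↭-reverse D) z∈)))

blockForms-sound : ∀ f {Sd π} → Descending Sd → π ∈ blockForms f Sd → π ↭ Sd × BlockForm π
blockForms-sound (suc f) {[]}     _            (here refl) = ↭-refl , []
blockForms-sound (suc f) {M ∷ Sd} (Sd<M ∷ dSd) π∈ with find (∈-concatMap⁻ (withLastBlock f M) π∈)
... | (K , D) , p∈ , π∈′ with ∈-map⁻ (_++ M ∷ reverse D) π∈′
...   | π′ , π′∈ , refl = let il = splits-sound Sd p∈ ; (π′↭ , gπ′) = blockForms-sound f (Interleaving-AllPairsˡ il dSd) π′∈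
                          in last-block-sound Sd<M dSd il π′↭ gπ′

last-block-split : ∀ {M Sd π′ M′ D′} → Descending (M ∷ Sd) → π′ ++ M′ ∷ D′ ↭ M ∷ Sd →
                   All (_< M′) π′ → All (_< M′) D′ → Ascending D′ →
                   ∃[ K ] ∃[ D ] Interleaving K D Sd × π′ ++ M′ ∷ D′ ≡ π′ ++ M ∷ reverse D × π′ ↭ K
last-block-split {M} {Sd} {π′} {M′} {D′} (Sd<M ∷ dSd) π↭ π′<M′ D′<M′ ascD′ =
  K , D , il , cong₂ (λ a b → π′ ++ a ∷ b) M′≡M (sym rD≡D′) , π′↭K
  where
  uπ : Unique (π′ ++ M′ ∷ D′)
  uπ = Unique-resp-↭ (↭-sym π↭) (Descending⇒Unique (Sd<M ∷ dSd))
  D′? = λ z → z ∈? D′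
  K = filter (λ z → ¬? (D′? z)) Sd
  D = filter D′? Sd
  il = filter-interleaving D′? Sd
  ≤M′ : ∀ {z} → z ∈ π′ ++ M′ ∷ D′ → z ≤ M′
  ≤M′ z∈ with ∈-++⁻ π′ z∈
  ... | inj₁ z∈π′         = <⇒≤ (All.lookup π′<M′ z∈π′)
  ... | inj₂ (here refl)  = ≤-refl
  ... | inj₂ (there z∈D′) = <⇒≤ (All.lookup D′<M′ z∈D′)
  M′≡M : M′ ≡ M
  M′≡M with ∈-resp-↭ π↭ (∈-insert π′)
  ... | here M′≡M   = M′≡M
  ... | there M′∈Sd = ⊥-elim (<⇒≱ (All.lookup Sd<M M′∈Sd) (≤M′ (∈-resp-↭ (↭-sym π↭) (here refl))))
  inSd : ∀ {z} → z ∈ π′ ++ M′ ∷ D′ → z < M′ → z ∈ Sd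
  inSd z∈ z<M′ with ∈-resp-↭ π↭ z∈
  ... | here refl = ⊥-elim (<-irrefl (sym M′≡M) z<M′)
  ... | there z∈Sd = z∈Sd
  rD≡D′ : reverse D ≡ D′
  rD≡D′ = Ascending-determined (Descending-reverse (Interleaving-AllPairsʳ il dSd)) ascD′
    (λ z∈ → proj₂ (∈-filter⁻ D′? {xs = Sd} (∈-resp-↭ (↭-reverse D) z∈)))
    (λ z∈ → ∈-resp-↭ (↭-sym (↭-reverse D)) (∈-filter⁺ D′? (inSd (∈-++⁺ʳ π′ (there z∈)) (All.lookup D′<M′ z∈)) z∈))
  π′↭K : π′ ↭ K
  π′↭K = Unique⇒↭ (Unique-++⁻ˡ π′ uπ) (Interleaving-AllPairsˡ il (Descending⇒Unique dSd))
    (λ z∈ → ∈-filter⁺ (λ z → ¬? (D′? z)) (inSd (∈-++⁺ˡ z∈) (All.lookup π′<M′ z∈))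
                                         (λ z∈D′ → Unique-++-disjoint π′ uπ z∈ (there z∈D′)))
    (λ z∈ → let (z∈Sd , z∉D′) = ∈-filter⁻ (λ z → ¬? (D′? z)) {xs = Sd} z∈ in back z∈Sd z∉D′)
    where
    back : ∀ {z} → z ∈ Sd → z ∉ D′ → z ∈ π′
    back z∈Sd z∉D′ with ∈-++⁻ π′ (∈-resp-↭ (↭-sym π↭) (there z∈Sd))
    ... | inj₁ z∈π′         = z∈π′
    ... | inj₂ (here refl)  = ⊥-elim (<-irrefl M′≡M (All.lookup Sd<M z∈Sd))
    ... | inj₂ (there z∈D′) = ⊥-elim (z∉D′ z∈D′)

blockForms-complete : ∀ f {Sd π} → length Sd < f → Descending Sd → π ↭ Sd → BlockForm π → π ∈ blockForms f Sd
blockForms-complete (suc f) {[]}    _ _ _  [] = here refl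
blockForms-complete (suc f) {_ ∷ _} _ _ π↭ [] with ↭-length π↭
... | ()
blockForms-complete (suc f) {[]}    _ _ π↭ (snoc {π′} _ _ _ _ _ _) with ∈-resp-↭ π↭ (∈-insert π′)
... | ()
blockForms-complete (suc f) {M ∷ Sd} (s≤s |Sd|<f) dMSd@(_ ∷ dSd) π↭ (snoc {π′} M′ D′ gπ′ π′<M′ D′<M′ ascD′)
  with last-block-split dMSd π↭ π′<M′ D′<M′ ascD′
... | K , D , il , π≡ , π′↭K = subst (_∈ blockForms (suc f) (M ∷ Sd)) (sym π≡)
  (∈-concatMap⁺ (withLastBlock f M) (lose (splits-complete il) (∈-map⁺ (_++ M ∷ reverse D)
    (blockForms-complete f (≤-<-trans |K|≤ |Sd|<f) (Interleaving-AllPairsˡ il dSd) π′↭K gπ′))))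
  where
  |K|≤ : length K ≤ length Sd
  |K|≤ = ≤-trans (m≤m+n _ _) (≤-reflexive (sym (interleave-length il)))

blockForms-unique : ∀ f {Sd} → Descending Sd → Unique (blockForms f Sd)
blockForms-unique zero    _ = []
blockForms-unique (suc f) {[]} _ = [] ∷ []
blockForms-unique (suc f) {M ∷ Sd} (Sd<M ∷ dSd) =
  Unique-concatMap (withLastBlock f M) (splits-unique (Descending⇒Unique dSd)) unique-ext same-split
  where
  sublist : ∀ {K D} → (K , D) ∈ splits Sd → Descending K
  sublist p∈ = Interleaving-AllPairsˡ (splits-sound Sd p∈) dSd
  unique-ext : ∀ {p} → p ∈ splits Sd → Unique (withLastBlock f M p)
  unique-ext {K , D} p∈ = Unique.map⁺ (++-cancelʳ (M ∷ reverse D) _ _) (blockForms-unique f (sublist p∈))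
  M∉ : ∀ {K D π} → (K , D) ∈ splits Sd → π ∈ blockForms f K → M ∉ π
  M∉ {K} p∈ π∈ M∈ = <-irrefl refl (All.lookup Sd<M
    (∈-interleavingˡ (splits-sound Sd p∈) (∈-resp-↭ (proj₁ (blockForms-sound f (sublist p∈) π∈)) M∈)))
  same-split : ∀ {p q y} → p ∈ splits Sd → q ∈ splits Sd → y ∈ withLastBlock f M p → y ∈ withLastBlock f M q → p ≡ q
  same-split {K₁ , D₁} {K₂ , D₂} p∈ q∈ y∈₁ y∈₂ with ∈-map⁻ (_++ M ∷ reverse D₁) y∈₁ | ∈-map⁻ (_++ M ∷ reverse D₂) y∈₂
  ... | π₁ , π₁∈ , refl | π₂ , π₂∈ , y≡ with ∉-++-∷-cancel π₁ π₂ (M∉ p∈ π₁∈) (M∉ q∈ π₂∈) y≡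
  ...   | _ , rD≡ with reverse-injective {x = D₁} {y = D₂} rD≡
  ...     | refl with Interleaving-determinedˡ (Descending⇒Unique dSd) (splits-sound Sd p∈) (splits-sound Sd q∈)
  ...       | refl = refl

blockForms-length : ∀ f {Sd} → length Sd < f → Descending Sd → length (blockForms f Sd) ≡ bell (length Sd)
blockForms-length (suc f) {[]}     _            _            = refl
blockForms-length (suc f) {M ∷ Sd} (s≤s |Sd|<f) (_ ∷ dSd) = begin
  length (concatMap (withLastBlock f M) (splits Sd))         ≡⟨ length-concatMap (withLastBlock f M) (splits Sd) ⟩
  sum (map (length ∘ withLastBlock f M) (splits Sd))         ≡⟨ cong sum (map-cong-local (All.tabulate count)) ⟩
  sum (map (bell ∘ length ∘ proj₁) (splits Sd))              ≡⟨ splits-count Sd bell ⟩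
  binomialSum (length Sd) bell                               ≡⟨ sym (bell-suc (length Sd)) ⟩
  bell (suc (length Sd))                                     ∎
  where
  open ≡.≡-Reasoning
  count : ∀ {p} → p ∈ splits Sd → length (withLastBlock f M p) ≡ bell (length (proj₁ p))
  count {K , D} p∈ = ≡.trans (length-map _ (blockForms f K))
    (blockForms-length f (≤-<-trans (≤-trans (m≤m+n _ _) (≤-reflexive (sym (interleave-length il)))) |Sd|<f)
                         (Interleaving-AllPairsˡ il dSd))
    where il = splits-sound Sd p∈

module _ (t : ℕ) where

  private
    m = 3 + t
    n = 2 * m ∸ 3
    N = t + m
    T = interval m t

    ↭n⇒↭N : ∀ {π} → π ↭ range1 n → π ↭ range1 N
    ↭n⇒↭N {π} = subst (λ k → π ↭ range1 k) (2m∸3≡ t)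

    ↭N⇒↭n : ∀ {π} → π ↭ range1 N → π ↭ range1 n
    ↭N⇒↭n {π} = subst (λ k → π ↭ range1 k) (sym (2m∸3≡ t))

    ++T-↭ : ∀ {β} → β ↭ range1 m → β ++ T ↭ range1 N
    ++T-↭ {β} β↭ = subst (β ++ T ↭_) (sym (range1-+ m t)) (++⁺ʳ T β↭)

    ≪T : ∀ {β} → β ↭ range1 m → β ≪ T
    ≪T β↭ = All.map (λ x≤m → All.map (≤-<-trans x≤m) (interval-above m t)) (perm-bounded β↭)

  Condition₁ Condition₂ : List ℕ → Set
  Condition₁ π = t ≤ tl n π × ((x : ℕ) → DescentTop π x → LRMax π x)
  Condition₂ π = Σ ℕ λ ℓ → 3 ≤ ℓ × ℓ ≤ m × π ≡ zeta ℓ m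

  image⇒tail : ∀ {π} → InImage t n π → ∃[ β ] β ↭ range1 m × π ≡ β ++ T
  image⇒tail (σ , σ↭ , refl) = iter-s-tail t (↭n⇒↭N σ↭)

  preimage⇒image : ∀ {π σ} → IsPerm n π → iter t s σ ≡ π → InImage t n π
  preimage⇒image {π} {σ} π↭ iter≡ = σ , ↭-trans (↭-sym (subst (_↭ σ) iter≡ (iter-s-↭ t σ))) π↭ , iter≡

  image⇒conditions : ∀ {π} → InImage t n π → Condition₁ π ⊎ Condition₂ π
  image⇒conditions {π} im@(σ , σ↭ , refl) with zeta? m π
  ... | yes ζ = inj₂ ζ
  ... | no ¬ζ = inj₁ (tail , lrmax)
    where
    π↭ = ↭-trans (iter-s-↭ t σ) (↭n⇒↭N σ↭)
    tail : t ≤ tl n π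
    tail with image⇒tail im
    ... | β , _ , π≡ = subst (λ k → t ≤ tl k π) (sym (2m∸3≡ t)) (subst (λ π → t ≤ tl N π) (sym π≡) (tl-interval⁺ t m β))
    lrmax : (x : ℕ) → DescentTop π x → LRMax π x
    lrmax x (ys , z , zs , π≡ , z<x) with All.all? (_<? x) ys
    ... | yes ys<x = ys , z ∷ zs , π≡ , ys<x
    ... | no  ys≮x with find (¬All⇒Any¬ (_<? x) ys ys≮x)
    ...   | y , y∈ , y≮x = ⊥-elim (¬ζ (nonLRMax-descent⇒zeta t (↭n⇒↭N σ↭) ys zs π≡ z<x (lose y∈ x<y)))
      where
      x<y : x < y
      x<y = ≤∧≢⇒< (≮⇒≥ y≮x) (λ { refl → proj₁ (Unique-mid-∉ ys (subst Unique π≡ (perm-unique π↭))) y∈ })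

  conditions⇒image : ∀ {π} → IsPerm n π → Condition₁ π ⊎ Condition₂ π → InImage t n π
  conditions⇒image {π} π↭ (inj₁ (tail , lrmax)) =
    let (σ , iter≡) = tail-DescentTopsLRMax⇒image t m (↭n⇒↭N π↭) (subst (λ k → t ≤ tl k π) (2m∸3≡ t) tail)
                        (LRMax⇒DescentTopsLRMax (perm-unique π↭) lrmax)
    in preimage⇒image π↭ iter≡
  conditions⇒image π↭ (inj₂ (ℓ , 3≤ℓ , ℓ≤m , refl)) = preimage⇒image π↭ (proj₂ (zeta-preimage t 3≤ℓ ℓ≤m))

  characterization : ∀ π → IsPerm n π → InImage t n π ⇔ (Condition₁ π ⊎ Condition₂ π)
  characterization π π↭ = mk⇔ image⇒conditions (conditions⇒image π↭)

  image : List (List ℕ)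
  image = map (_++ T) (blockForms (suc m) (range1↓ m)) ++ map (λ ℓ → zeta ℓ m) (interval 2 (suc t))

  condition₁⇒blockForm : ∀ {π} → InImage t n π → ((x : ℕ) → DescentTop π x → LRMax π x) →
                         ∃[ β ] β ↭ range1 m × BlockForm β × π ≡ β ++ T
  condition₁⇒blockForm im lrmax with image⇒tail im
  ... | β , β↭ , refl = β , β↭ , DescentTopsLRMax⇒BlockForm (Unique-++⁻ˡ β uπ) (DescentTopsLRMax-++⁻ˡ β dt) , refl
    where
    uπ = perm-unique (++T-↭ β↭)
    dt = LRMax⇒DescentTopsLRMax uπ lrmax

  blockForm-tail⇒image : ∀ {β} → β ↭ range1 m → BlockForm β → InImage t n (β ++ T)
  blockForm-tail⇒image {β} β↭ gβ =
    preimage⇒image (↭N⇒↭n (++T-↭ β↭))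
                   (proj₂ (map₂ (subst (λ k → iter k s _ ≡ β ++ T) (length-interval m t))
                                (iter-preimage gβ T (interval-ascending m t) (≪T β↭))))

  ∈-image⁺ : ∀ {π} → InImage t n π → π ∈ image
  ∈-image⁺ {π} im with image⇒conditions im
  ... | inj₂ (ℓ , 3≤ℓ , ℓ≤m , refl) =
    ∈-++⁺ʳ (map (_++ T) _) (∈-map⁺ (λ ℓ → zeta ℓ m) (∈-interval⁺ 2 (suc t) 3≤ℓ (≤-trans ℓ≤m (≤-reflexive (cong suc (+-comm 2 t))))))
  ... | inj₁ (_ , lrmax) with condition₁⇒blockForm im lrmax
  ...   | β , β↭ , gβ , refl = ∈-++⁺ˡ (∈-map⁺ (_++ T)
    (blockForms-complete (suc m) (s≤s (≤-reflexive (length-applyDownFrom suc m))) (range1↓-descending m)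
                         (↭-trans β↭ (↭-sym (range1↓-↭ m))) gβ))

  ∈-image⁻ : ∀ {π} → π ∈ image → InImage t n π
  ∈-image⁻ π∈ with ∈-++⁻ (map (_++ T) (blockForms (suc m) (range1↓ m))) π∈
  ... | inj₁ π∈ˡ with ∈-map⁻ (_++ T) π∈ˡ
  ...   | β , β∈ , refl with blockForms-sound (suc m) (range1↓-descending m) β∈
  ...     | β↭ , gβ = blockForm-tail⇒image (↭-trans β↭ (range1↓-↭ m)) gβ
  ∈-image⁻ π∈ | inj₂ π∈ʳ with ∈-map⁻ (λ ℓ → zeta ℓ m) π∈ʳ
  ...   | ℓ , ℓ∈ , refl with ∈-interval⁻ 2 (suc t) ℓ∈
  ...     | 2<ℓ , ℓ≤ = conditions⇒image (↭N⇒↭n (zeta-perm t 2<ℓ (≤-trans ℓ≤m (m≤n+m m t)))) (inj₂ (ℓ , 2<ℓ , ℓ≤m , refl))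
    where
    ℓ≤m : ℓ ≤ m
    ℓ≤m = ≤-trans ℓ≤ (≤-reflexive (cong suc (+-comm t 2)))

  image-unique : Unique image
  image-unique = Unique.++⁺ (Unique.map⁺ (++-cancelʳ T _ _) (blockForms-unique (suc m) (range1↓-descending m)))
                            (Unique.map⁺ ∷-injectiveˡ (Ascending⇒Unique (interval-ascending 2 (suc t)))) disjoint
    where
    disjoint : ∀ {π} → ¬ (π ∈ map (_++ T) (blockForms (suc m) (range1↓ m)) × π ∈ map (λ ℓ → zeta ℓ m) (interval 2 (suc t)))
    disjoint (π∈ˡ , π∈ʳ) with ∈-map⁻ (_++ T) π∈ˡ | ∈-map⁻ (λ ℓ → zeta ℓ m) π∈ʳ
    ... | β , β∈ , refl | ℓ , ℓ∈ , π≡ with blockForms-sound (suc m) (range1↓-descending m) β∈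
    ...   | β↭ , gβ with DescentTopsLRMax-++ (BlockForm⇒DescentTopsLRMax gβ) (interval-ascending m t)
                                             (≪T (↭-trans β↭ (range1↓-↭ m))) [ ℓ ] _ π≡ (s≤s (s≤s z≤n))
    ...     | ℓ<2 ∷ [] = <-asym ℓ<2 (proj₁ (∈-interval⁻ 2 (suc t) ℓ∈))

  image-length : length image ≡ bell m + m ∸ 2
  image-length = begin
    length image                                                  ≡⟨ length-++ (map (_++ T) (blockForms (suc m) (range1↓ m))) ⟩
    length (map (_++ T) Bs) + length (map (λ ℓ → zeta ℓ m) Ls)    ≡⟨ cong₂ _+_ (length-map (_++ T) Bs) (length-map (λ ℓ → zeta ℓ m) Ls) ⟩
    length (blockForms (suc m) (range1↓ m)) + length (interval 2 (suc t))
      ≡⟨ cong₂ _+_ (blockForms-length (suc m) (s≤s (≤-reflexive |range1↓|)) (range1↓-descending m)) (length-interval 2 (suc t)) ⟩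
    bell (length (range1↓ m)) + suc t                             ≡⟨ cong (λ k → bell k + suc t) |range1↓| ⟩
    bell m + (m ∸ 2)                                              ≡⟨ sym (+-∸-assoc (bell m) (s≤s (s≤s z≤n))) ⟩
    bell m + m ∸ 2                                                ∎
    where
    open ≡.≡-Reasoning
    |range1↓| = length-applyDownFrom suc m
    Bs = blockForms (suc m) (range1↓ m)
    Ls = interval 2 (suc t)

  enumeration : Σ (List (List ℕ)) λ L → Unique L × (∀ π → π ∈ L ⇔ InImage t n π) × length L ≡ bell m + m ∸ 2
  enumeration = image , image-unique , (λ π → mk⇔ ∈-image⁻ ∈-image⁺) , image-length

theorem1p2 : (m : ℕ) → 3 ≤ m →
    ((π : List ℕ) → IsPerm (2 * m ∸ 3) π →
      (InImage (m ∸ 3) (2 * m ∸ 3) π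
        ⇔ (((m ∸ 3 ≤ tl (2 * m ∸ 3) π) × ((x : ℕ) → DescentTop π x → LRMax π x))
           ⊎ Σ ℕ (λ ℓ → (3 ≤ ℓ) × (ℓ ≤ m) × (π ≡ zeta ℓ m)))))
    × Σ (List (List ℕ)) (λ L → Unique L
        × ((π : List ℕ) → (π ∈ L ⇔ InImage (m ∸ 3) (2 * m ∸ 3) π))
        × (length L ≡ bell m + m ∸ 2))
theorem1p2 (suc (suc (suc t))) (s≤s (s≤s (s≤s z≤n))) = characterization t , enumeration t
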